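{- Let $Q_n$ be the $n$-dimensional hypercube graph and, for nonnegative integers $r$, let $K(n,r)$ be the minimum number of balls of radius $r$ in $Q_n$ whose union is $V(Q_n)$. Then: (i) $n \le A(Q_n) \le n-1+\lceil \log(n+1)\rceil$. (ii) $K(n,r)-1 \le A(Q_n,\le r) \le K(n,r)+n-1+\lceil \log(r+1)\rceil$. Moreover, there is a constant $C$ such that if $r \le n/2 - C\sqrt{n}\log n$, then $A(Q_n,\le r)=(1+o(1))K(n,r)$ as $n\to\infty$. (iii) $K(n,r)-1 \le A(Q_n,r) \le K(n,r)+\sum_{i=0}^r \binom{n}{i}$. Moreover, there is a constant $C'$ such that if $r \le C'n$, then $A(Q_n,r)=(1+o(1))K(n,r)$ as $n\to\infty$.
   Context: $Q_n$ is the graph on the set of all $0$-$1$ vectors of length $n$, two vectors adjacent iff they differ in exactly one coordinate; the graph distance is the Hamming distance. For a graph $G$, a vertex $u$ and integer $r\ge 0$, the ball $B(u,r)$ is the set of vertices at distance at most $r$ from $u$. In the search problem an unknown vertex $v\in V(G)$ must be determined by queries of the form "is $v\in B(u,r)$?". $A(G,r)$ is the minimum number of queries needed in the worst case to determine $v$ adaptively (each query may depend on previous answers) when all queried balls have radius exactly $r$; $A(G,\le r)$ is the same when queried balls may have any radius at most $r$; $A(G)$ is the same when balls of any radius are allowed. "$\log$" denotes logarithm to base 2. -}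

module Defs where

open import Data.Bool using (Bool; true; false; if_then_else_)
open import Data.Nat using (ℕ; zero; suc; _+_; _*_; _∸_; _^_; _≤_; _<_; _⊔_; _≤?_)
open import Data.Nat.Logarithm using (⌈log₂_⌉)
open import Data.Nat.Combinatorics using (_C_)
open import Data.Fin using (Fin)
open import Data.Vec using (Vec; []; _∷_; lookup)
open import Data.List using (List; map; upTo)
open import Data.Nat.ListAction using (sum)
open import Data.Product using (Σ; ∃; _×_)
open import Data.Unit using (⊤)
open import Relation.Nullary using (yes; no)
open import Relation.Binary.PropositionalEquality using (_≡_)

Vertex : ℕ → Set
Vertex n = Vec Bool n

differ : Bool → Bool → ℕ
differ true  true  = 0
differ false false = 0
differ _     _     = 1

-- Hamming distance (= graph distance in Q_n).
dist : ∀ {n} → Vertex n → Vertex n → ℕ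
dist []       []       = 0
dist (x ∷ xs) (y ∷ ys) = differ x y + dist xs ys

InBall : ∀ {n} → Vertex n → ℕ → Vertex n → Set
InBall u r v = dist u v ≤ r

-- Adaptive search strategy = decision tree.  A node  query u ρ yes no  asks
-- "is v ∈ B(u , ρ)?" and continues with  yes  or  no  according to the answer;
-- a leaf announces the vertex found.
data Tree (n : ℕ) : Set where
  leaf  : Vertex n → Tree n
  query : Vertex n → ℕ → Tree n → Tree n → Tree n

AllRadii : ∀ {n} → (ℕ → Set) → Tree n → Set
AllRadii P (leaf _)          = ⊤
AllRadii P (query u ρ t₁ t₂) = P ρ × AllRadii P t₁ × AllRadii P t₂

run : ∀ {n} → Tree n → Vertex n → Vertex n
run (leaf w) v = w
run (query u ρ t₁ t₂) v with dist u v ≤? ρ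
... | yes _ = run t₁ v
... | no  _ = run t₂ v

cost : ∀ {n} → Tree n → Vertex n → ℕ
cost (leaf w) v = 0
cost (query u ρ t₁ t₂) v with dist u v ≤? ρ
... | yes _ = suc (cost t₁ v)
... | no  _ = suc (cost t₂ v)

Solvable : (n : ℕ) → (ℕ → Set) → ℕ → Set
Solvable n P d = Σ (Tree n) λ t →
  AllRadii P t × (∀ (v : Vertex n) → run t v ≡ v × cost t v ≤ d)

IsMinimum : (ℕ → Set) → ℕ → Set
IsMinimum Q m = Q m × (∀ k → Q k → m ≤ k)

AnyRadius : ℕ → Set
AnyRadius _ = ⊤

RadiusAtMost : ℕ → ℕ → Set
RadiusAtMost r ρ = ρ ≤ r

RadiusExactly : ℕ → ℕ → Set
RadiusExactly r ρ = ρ ≡ r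

IsA : ℕ → ℕ → Set
IsA n a = IsMinimum (Solvable n AnyRadius) a

IsA≤ : ℕ → ℕ → ℕ → Set
IsA≤ n r a = IsMinimum (Solvable n (RadiusAtMost r)) a

IsA= : ℕ → ℕ → ℕ → Set
IsA= n r a = IsMinimum (Solvable n (RadiusExactly r)) a

Covers : ℕ → ℕ → ℕ → Set
Covers n r k = Σ (Vec (Vertex n) k) λ cs →
  ∀ (v : Vertex n) → ∃ λ (i : Fin k) → InBall (lookup cs i) r v

IsK : ℕ → ℕ → ℕ → Set
IsK n r k = IsMinimum (Covers n r) k

binomSum : ℕ → ℕ → ℕ
binomSum n r = sum (map (n C_) (upTo (suc r)))

module Submission where

-- Upper bounds are explicit decision trees.  Knowing a ball B(c, r) ∋ v,
-- binary search finds w = d(c, v) with ⌈log₂ (r+1)⌉ queries of radius ≤ r,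
-- and then v is read off coordinate by coordinate with n - 1 queries.
-- Querying the balls of a minimum cover in turn and searching inside the
-- first one containing v gives (i) and (ii).  With radius exactly r < n, two
-- candidates are always separated by some radius-r ball, so the |B(c, r)|
-- candidates of a ball are eliminated one by one: this gives (iii).
-- Lower bounds: a tree of depth a has ≤ 2^a outcomes, so n ≤ A(Q_n); the
-- balls on its all-"no" path plus the leaf there cover Q_n, so K ≤ a + 1.
-- For the asymptotics, K(n, r) ≥ 2^n / |B(c, r)|, and Chernoff-type volume
-- estimates show the additive error terms are o(K(n, r)).

open import Defs
open import Data.Nat using (ℕ; zero; suc; _+_; _*_; _∸_; _^_; _≤_; _<_)
open import Data.Nat.Logarithm using (⌈log₂_⌉)
open import Data.Product using (Σ; _×_)

open import Data.Bool using (Bool; true; false; not)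
open import Data.Bool.Properties using () renaming (_≟_ to _≟ᵇ_)
open import Data.Nat using (z≤n; s≤s; _≤?_; _⊓_; ⌊_/2⌋; ⌈_/2⌉)
open import Data.Nat.Properties
open import Data.Nat.Logarithm using (⌈log₂⌉-mono-≤; ⌈log₂2^n⌉≡n; ⌈log₂⌈n/2⌉⌉≡⌈log₂n⌉∸1)
open import Data.Nat.Induction using (<-rec)
open import Data.Nat.Combinatorics using (_C_; nCk+nC[k+1]≡[n+1]C[k+1])
open import Data.Nat.ListAction using (sum)
open import Data.Nat.ListAction.Properties using (sum-++)
open import Data.Nat.Tactic.RingSolver using (solve-∀)
open import Data.Vec using (Vec; []; _∷_; lookup)
open import Data.Vec.Properties using (≡-dec)
open import Data.Fin using (Fin; zero; suc)
open import Data.List using (List; []; _∷_; length; _++_; map; upTo; filter)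
open import Data.List.Properties using (length-++; length-map; map-++; applyUpTo-∷ʳ; filter-notAll)
open import Data.List.Relation.Unary.Any using (here; there)
import Data.List.Relation.Unary.Any as Any
open import Data.List.Membership.Propositional using (_∈_)
open import Data.List.Membership.Propositional.Properties using (∈-++⁺ˡ; ∈-++⁺ʳ; ∈-map⁺; ∈-filter⁺)
open import Data.Product using (_,_; proj₁; proj₂)
open import Data.Sum using (_⊎_; inj₁; inj₂)
open import Data.Unit using (tt)
open import Data.Empty using (⊥-elim)
open import Relation.Nullary using (¬_; yes; no; ¬?)
open import Relation.Unary using (Decidable)
open import Relation.Binary.PropositionalEquality

pow-pos : ∀ x n → 1 ≤ x → 1 ≤ x ^ n
pow-pos x zero    _   = ≤-refl
pow-pos x (suc n) 1≤x = *-mono-≤ 1≤x (pow-pos x n 1≤x)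

^-distribʳ-* : ∀ x y n → (x * y) ^ n ≡ x ^ n * y ^ n
^-distribʳ-* x y zero    = refl
^-distribʳ-* x y (suc n) =
  trans (cong (x * y *_) (^-distribʳ-* x y n)) (swap x y (x ^ n) (y ^ n))
  where
    swap : ∀ a b c d → a * b * (c * d) ≡ a * c * (b * d)
    swap = solve-∀

*-cancelʳ-≤′ : ∀ a b c → 1 ≤ c → a * c ≤ b * c → a ≤ b
*-cancelʳ-≤′ a b (suc c) _ = *-cancelʳ-≤ a b (suc c)

*-cancelˡ-≤′ : ∀ a b c → 1 ≤ c → c * a ≤ c * b → a ≤ b
*-cancelˡ-≤′ a b c 1≤c h = *-cancelʳ-≤′ a b c 1≤c (subst₂ _≤_ (*-comm c a) (*-comm c b) h)

pow-cancel-≤ : ∀ k x y → x ^ suc k ≤ y ^ suc k → x ≤ y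
pow-cancel-≤ k x y h with x ≤? y
... | yes x≤y = x≤y
... | no  x≰y = ⊥-elim (<⇒≱ (^-monoˡ-< (suc k) (≰⇒> x≰y)) h)

1≤⌈log₂[2+k]⌉ : ∀ k → 1 ≤ ⌈log₂ (suc (suc k)) ⌉
1≤⌈log₂[2+k]⌉ k =
  subst (_≤ ⌈log₂ (suc (suc k)) ⌉) (⌈log₂2^n⌉≡n 1) (⌈log₂⌉-mono-≤ {2} {suc (suc k)} (s≤s (s≤s z≤n)))

-- m ≤ 2 ^ ⌈log₂ m⌉, by strong induction via m ≤ 2 ⌈m/2⌉.
≤2^⌈log₂⌉ : ∀ m → m ≤ 2 ^ ⌈log₂ m ⌉
≤2^⌈log₂⌉ = <-rec _ step
  where
    open ≤-Reasoning
    step : ∀ m → (∀ {k} → k < m → k ≤ 2 ^ ⌈log₂ k ⌉) → m ≤ 2 ^ ⌈log₂ m ⌉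
    step zero          _  = z≤n
    step (suc zero)    _  = ≤-refl
    step m@(suc (suc k)) ih = begin
        m                     ≡⟨ sym (⌊n/2⌋+⌈n/2⌉≡n m) ⟩
        ⌊ m /2⌋ + h           ≤⟨ +-monoˡ-≤ h (⌊n/2⌋≤⌈n/2⌉ m) ⟩
        h + h                 ≤⟨ +-mono-≤ ih-h ih-h ⟩
        2 ^ L′ + 2 ^ L′       ≡⟨ cong (2 ^ L′ +_) (sym (+-identityʳ _)) ⟩
        2 ^ suc L′            ≡⟨ cong (2 ^_) (m+[n∸m]≡n (1≤⌈log₂[2+k]⌉ k)) ⟩
        2 ^ ⌈log₂ m ⌉         ∎
      where
        h  = ⌈ m /2⌉
        L′ = ⌈log₂ m ⌉ ∸ 1
        ih-h : h ≤ 2 ^ L′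
        ih-h = subst (λ e → h ≤ 2 ^ e) (⌈log₂⌈n/2⌉⌉≡⌈log₂n⌉∸1 m) (ih (⌈n/2⌉<n k))

⌈log₂⌉-least : ∀ m L → m ≤ 2 ^ L → ⌈log₂ m ⌉ ≤ L
⌈log₂⌉-least m L m≤2^L = subst (⌈log₂ m ⌉ ≤_) (⌈log₂2^n⌉≡n L) (⌈log₂⌉-mono-≤ m≤2^L)

-- 2 ^ ⌈log₂ m⌉ ≤ 2 m for m ≥ 1 (minimality of ⌈log₂ m⌉).
2^⌈log₂⌉≤2*m : ∀ m → 1 ≤ m → 2 ^ ⌈log₂ m ⌉ ≤ 2 * m
2^⌈log₂⌉≤2*m m 1≤m with ⌈log₂ m ⌉ in eq
... | zero  = ≤-trans 1≤m (m≤m+n m (m + 0))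
... | suc L with 2 ^ L ≤? m
...   | yes 2^L≤m = subst₂ _≤_ (cong (2 ^ L +_) (sym (+-identityʳ _)))
                              (cong (m +_) (sym (+-identityʳ m))) (+-mono-≤ 2^L≤m 2^L≤m)
...   | no  2^L≰m = ⊥-elim (<⇒≱ (n<1+n L)
                      (subst (_≤ L) eq (⌈log₂⌉-least m L (<⇒≤ (≰⇒> 2^L≰m)))))

1+n≤2^n : ∀ n → 1 ≤ n → suc n ≤ 2 ^ n
1+n≤2^n (suc zero)    _ = s≤s (s≤s z≤n)
1+n≤2^n (suc (suc n)) _ = begin
    suc (suc (suc n))     ≤⟨ s≤s (1+n≤2^n (suc n) (s≤s z≤n)) ⟩
    suc x                 ≤⟨ +-monoˡ-≤ x (pow-pos 2 (suc n) (s≤s z≤n)) ⟩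
    x + x                 ≡⟨ cong (x +_) (sym (+-identityʳ x)) ⟩
    2 ^ suc (suc n)       ∎
  where
    open ≤-Reasoning
    x = 2 ^ suc n

dist-self : ∀ {n} (c : Vertex n) → dist c c ≡ 0
dist-self []          = refl
dist-self (true  ∷ c) = dist-self c
dist-self (false ∷ c) = dist-self c

dist≡0⇒≡ : ∀ {n} (c v : Vertex n) → dist c v ≡ 0 → v ≡ c
dist≡0⇒≡ []          []          _  = refl
dist≡0⇒≡ (true  ∷ c) (true  ∷ v) e  = cong (true  ∷_) (dist≡0⇒≡ c v e)
dist≡0⇒≡ (false ∷ c) (false ∷ v) e  = cong (false ∷_) (dist≡0⇒≡ c v e)
dist≡0⇒≡ (true  ∷ c) (false ∷ v) ()
dist≡0⇒≡ (false ∷ c) (true  ∷ v) ()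

dist≤n : ∀ {n} (c v : Vertex n) → dist c v ≤ n
dist≤n []          []          = z≤n
dist≤n (true  ∷ c) (true  ∷ v) = m≤n⇒m≤1+n (dist≤n c v)
dist≤n (false ∷ c) (false ∷ v) = m≤n⇒m≤1+n (dist≤n c v)
dist≤n (true  ∷ c) (false ∷ v) = s≤s (dist≤n c v)
dist≤n (false ∷ c) (true  ∷ v) = s≤s (dist≤n c v)

dist-pos : ∀ {n} (x y : Vertex n) → x ≢ y → 1 ≤ dist x y
dist-pos x y x≢y with dist x y in eq
... | zero  = ⊥-elim (x≢y (sym (dist≡0⇒≡ x y eq)))
... | suc _ = s≤s z≤n

origin : ∀ n → Vertex n
origin zero    = []
origin (suc n) = false ∷ origin n

record Finds {n} (t : Tree n) (v : Vertex n) (B : ℕ) : Set where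
  constructor finds
  field
    found  : run t v ≡ v
    within : cost t v ≤ B

finds-weaken : ∀ {n} {t : Tree n} {v B B′} → B ≤ B′ → Finds t v B → Finds t v B′
finds-weaken B≤B′ (finds found c≤B) = finds found (≤-trans c≤B B≤B′)

record Step {n} (t t′ : Tree n) (v : Vertex n) : Set where
  constructor step
  field
    same-answer : run t v ≡ run t′ v
    one-more    : cost t v ≡ suc (cost t′ v)

query-yes : ∀ {n} {u v : Vertex n} {ρ} t₁ t₂ → dist u v ≤ ρ → Step (query u ρ t₁ t₂) t₁ v
query-yes {u = u} {v} {ρ} t₁ t₂ inside = step (proj₁ eqs) (proj₂ eqs)
  where
    eqs : run (query u ρ t₁ t₂) v ≡ run t₁ v × cost (query u ρ t₁ t₂) v ≡ suc (cost t₁ v)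
    eqs with dist u v ≤? ρ
    ... | yes _       = refl , refl
    ... | no  outside = ⊥-elim (outside inside)

query-no : ∀ {n} {u v : Vertex n} {ρ} t₁ t₂ → ¬ dist u v ≤ ρ → Step (query u ρ t₁ t₂) t₂ v
query-no {u = u} {v} {ρ} t₁ t₂ outside = step (proj₁ eqs) (proj₂ eqs)
  where
    eqs : run (query u ρ t₁ t₂) v ≡ run t₂ v × cost (query u ρ t₁ t₂) v ≡ suc (cost t₂ v)
    eqs with dist u v ≤? ρ
    ... | yes inside = ⊥-elim (outside inside)
    ... | no  _      = refl , refl

finds-step : ∀ {n} {t t′ : Tree n} {v B} → Step t t′ v → Finds t′ v B → Finds t v (suc B)
finds-step (step run≡ cost≡) (finds found c≤B) =
  finds (trans run≡ found) (subst (_≤ suc _) (sym cost≡) (s≤s c≤B))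

finds-query : ∀ {n} {u v : Vertex n} {ρ B} t₁ t₂ →
              (dist u v ≤ ρ → Finds t₁ v B) → (¬ dist u v ≤ ρ → Finds t₂ v B) →
              Finds (query u ρ t₁ t₂) v (suc B)
finds-query {u = u} {v} {ρ} t₁ t₂ yes-case no-case with dist u v ≤? ρ
... | yes inside  = finds-step (query-yes t₁ t₂ inside) (yes-case inside)
... | no  outside = finds-step (query-no t₁ t₂ outside) (no-case outside)

AllRadii-mono : ∀ {n} {P Q : ℕ → Set} → (∀ {ρ} → P ρ → Q ρ) →
                (t : Tree n) → AllRadii P t → AllRadii Q t
AllRadii-mono P⇒Q (leaf _)          _              = tt
AllRadii-mono P⇒Q (query u ρ t₁ t₂) (p , a₁ , a₂) =
  P⇒Q p , AllRadii-mono P⇒Q t₁ a₁ , AllRadii-mono P⇒Q t₂ a₂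

AllRadii-any : ∀ {n} (t : Tree n) → AllRadii AnyRadius t
AllRadii-any (leaf _)          = tt
AllRadii-any (query u ρ t₁ t₂) = tt , AllRadii-any t₁ , AllRadii-any t₂

-- Run a tree of Q_n inside the subcube whose first coordinate is x.
lift : ∀ {n} → Bool → Tree n → Tree (suc n)
lift x (leaf w)          = leaf (x ∷ w)
lift x (query u ρ t₁ t₂) = query (x ∷ u) ρ (lift x t₁) (lift x t₂)

AllRadii-lift : ∀ {n} {P : ℕ → Set} x (t : Tree n) → AllRadii P t → AllRadii P (lift x t)
AllRadii-lift x (leaf _)          _              = tt
AllRadii-lift x (query u ρ t₁ t₂) (p , a₁ , a₂) = p , AllRadii-lift x t₁ a₁ , AllRadii-lift x t₂ a₂

dist-cons : ∀ x {n} (u v : Vertex n) → dist (x ∷ u) (x ∷ v) ≡ dist u v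
dist-cons true  u v = refl
dist-cons false u v = refl

-- Distances inside the subcube are unchanged, so the lifted tree behaves the same.
lift-agrees : ∀ {n} x (t : Tree n) v →
              run (lift x t) (x ∷ v) ≡ x ∷ run t v × cost (lift x t) (x ∷ v) ≡ cost t v
lift-agrees x (leaf w)          v = refl , refl
lift-agrees x (query u ρ t₁ t₂) v with dist u v ≤? ρ
... | yes inside
  with query-yes (lift x t₁) (lift x t₂) (subst (_≤ ρ) (sym (dist-cons x u v)) inside)
     | lift-agrees x t₁ v
...   | step run≡ cost≡ | run′ , cost′ = trans run≡ run′ , trans cost≡ (cong suc cost′)
lift-agrees x (query u ρ t₁ t₂) v | no outside
  with query-no (lift x t₁) (lift x t₂) (λ p → outside (subst (_≤ ρ) (dist-cons x u v) p))
     | lift-agrees x t₂ v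
...   | step run≡ cost≡ | run′ , cost′ = trans run≡ run′ , trans cost≡ (cong suc cost′)

finds-lift : ∀ {n} x (t : Tree n) v {B} → Finds t v B → Finds (lift x t) (x ∷ v) B
finds-lift x t v (finds found c≤B) = finds
  (trans (proj₁ (lift-agrees x t v)) (cong (x ∷_) found))
  (subst (_≤ _) (sym (proj₂ (lift-agrees x t v))) c≤B)

-- Knowing w = d(c, v), read v off coordinate by coordinate: the ball of
-- radius w - 1 around c with its first coordinate flipped contains v iff v
-- differs from c in that coordinate.  The last coordinate needs no query.
recover : ∀ {n} → Vertex n → ℕ → Tree n
recover c               zero    = leaf c
recover []              (suc w) = leaf []
recover (b ∷ [])        (suc w) = leaf (not b ∷ [])
recover (b ∷ c@(_ ∷ _)) (suc w) =
  query (not b ∷ c) w (lift (not b) (recover c w)) (lift b (recover c (suc w)))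

recover-radii : ∀ {n} (c : Vertex n) w → AllRadii (_< w) (recover c w)
recover-radii c               zero    = tt
recover-radii []              (suc w) = tt
recover-radii (b ∷ [])        (suc w) = tt
recover-radii (b ∷ c@(_ ∷ _)) (suc w) =
  ≤-refl ,
  AllRadii-lift (not b) (recover c w) (AllRadii-mono m<n⇒m<1+n (recover c w) (recover-radii c w)) ,
  AllRadii-lift b (recover c (suc w)) (recover-radii c (suc w))

-- If v kept the coordinate of c, the flipped centre is at distance w + 2 > w - 1.
overshoot : ∀ {d w} → d ≡ suc w → ¬ suc d ≤ w
overshoot refl p = 1+n≰n (≤-trans (n≤1+n _) p)

recover-finds : ∀ {n} (c : Vertex n) w v → dist c v ≡ w → Finds (recover c w) v (n ∸ 1)
recover-finds c zero v e = finds (sym (dist≡0⇒≡ c v e)) z≤n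
recover-finds [] (suc w) [] ()
recover-finds (true  ∷ []) (suc w) (true  ∷ []) ()
recover-finds (false ∷ []) (suc w) (false ∷ []) ()
recover-finds (true  ∷ []) (suc w) (false ∷ []) _ = finds refl z≤n
recover-finds (false ∷ []) (suc w) (true  ∷ []) _ = finds refl z≤n
recover-finds (true ∷ c@(_ ∷ _)) (suc w) (false ∷ v) e =
  finds-step (query-yes _ _ (≤-reflexive (suc-injective e)))
    (finds-lift false (recover c w) v (recover-finds c w v (suc-injective e)))
recover-finds (false ∷ c@(_ ∷ _)) (suc w) (true ∷ v) e =
  finds-step (query-yes _ _ (≤-reflexive (suc-injective e)))
    (finds-lift true (recover c w) v (recover-finds c w v (suc-injective e)))
recover-finds (true ∷ c@(_ ∷ _)) (suc w) (true ∷ v) e =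
  finds-step (query-no _ _ (overshoot e)) (finds-lift true (recover c (suc w)) v (recover-finds c (suc w) v e))
recover-finds (false ∷ c@(_ ∷ _)) (suc w) (false ∷ v) e =
  finds-step (query-no _ _ (overshoot e)) (finds-lift false (recover c (suc w)) v (recover-finds c (suc w) v e))

-- Binary search for d(c, v), known to lie in [lo, lo + 2 ^ L) and to be ≤ r,
-- followed by recovery.  The threshold radius is capped at r.
distSearch : ∀ {n} → Vertex n → ℕ → ℕ → ℕ → Tree n
distSearch c r lo zero    = recover c (lo ⊓ r)
distSearch c r lo (suc L) =
  query c ((lo + 2 ^ L ∸ 1) ⊓ r) (distSearch c r lo L) (distSearch c r (lo + 2 ^ L) L)

distSearch-radii : ∀ {n} (c : Vertex n) r lo L → AllRadii (_≤ r) (distSearch c r lo L)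
distSearch-radii c r lo zero    =
  AllRadii-mono (λ ρ<w → ≤-trans (<⇒≤ ρ<w) (m⊓n≤n lo r)) (recover c (lo ⊓ r)) (recover-radii c (lo ⊓ r))
distSearch-radii c r lo (suc L) =
  m⊓n≤n _ r , distSearch-radii c r lo L , distSearch-radii c r (lo + 2 ^ L) L

below-threshold : ∀ {d m} r → 1 ≤ m → d ≤ (m ∸ 1) ⊓ r → d < m
below-threshold {d} {m} r 1≤m p =
  subst (suc d ≤_) (m+[n∸m]≡n 1≤m) (s≤s (≤-trans p (m⊓n≤m (m ∸ 1) r)))

above-threshold : ∀ {d m r} → d ≤ r → ¬ d ≤ (m ∸ 1) ⊓ r → m ≤ d
above-threshold {d} {m} d≤r outside with m ≤? d
... | yes m≤d = m≤d
... | no  m≰d = ⊥-elim (outside (⊓-glb (∸-monoˡ-≤ 1 (≰⇒> m≰d)) d≤r))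

-- Each query halves the interval for d(c, v); at length 1, d(c, v) is known.
distSearch-finds : ∀ {n} (c : Vertex n) r lo L v → dist c v ≤ r →
                   lo ≤ dist c v → dist c v < lo + 2 ^ L →
                   Finds (distSearch c r lo L) v (L + (n ∸ 1))
distSearch-finds c r lo zero v d≤r lo≤d d<lo+1 =
  recover-finds c (lo ⊓ r) v (trans d≡lo (sym (m≤n⇒m⊓n≡m (subst (_≤ r) d≡lo d≤r))))
  where
    d≡lo : dist c v ≡ lo
    d≡lo = ≤-antisym (≤-pred (subst (dist c v <_) (+-comm lo 1) d<lo+1)) lo≤d
distSearch-finds c r lo (suc L) v d≤r lo≤d d<hi = finds-query _ _
  (λ inside → distSearch-finds c r lo L v d≤r lo≤d
    (below-threshold r (≤-trans (pow-pos 2 L (s≤s z≤n)) (m≤n+m _ lo)) inside))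
  (λ outside → distSearch-finds c r (lo + 2 ^ L) L v d≤r (above-threshold d≤r outside)
      (subst (dist c v <_) (sym (+-assoc lo (2 ^ L) (2 ^ L)))
        (subst (λ x → dist c v < lo + (2 ^ L + x)) (+-identityʳ (2 ^ L)) d<hi)))

locate : ∀ {n} → Vertex n → ℕ → Tree n
locate c r = distSearch c r 0 ⌈log₂ (suc r) ⌉

locate-radii : ∀ {n} (c : Vertex n) r → AllRadii (_≤ r) (locate c r)
locate-radii c r = distSearch-radii c r 0 ⌈log₂ (suc r) ⌉

locate-finds : ∀ {n} (c : Vertex n) r v → dist c v ≤ r →
               Finds (locate c r) v (⌈log₂ (suc r) ⌉ + (n ∸ 1))
locate-finds c r v d≤r =
  distSearch-finds c r 0 ⌈log₂ (suc r) ⌉ v d≤r z≤n (≤-trans (s≤s d≤r) (≤2^⌈log₂⌉ (suc r)))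

-- Query the centres of a cover by balls of radius r one after another (the
-- last one need not be asked); inside the first ball that contains v
-- continue with the strategy  f c  for that ball.
coverSearch : ∀ {n k} → (Vertex n → Tree n) → ℕ → Vec (Vertex n) (suc k) → Tree n
coverSearch f r (c ∷ [])          = f c
coverSearch f r (c ∷ cs@(_ ∷ _)) = query c r (f c) (coverSearch f r cs)

coverSearch-radii : ∀ {n k} {P : ℕ → Set} (f : Vertex n → Tree n) r → P r →
                    (∀ c → AllRadii P (f c)) → (cs : Vec (Vertex n) (suc k)) →
                    AllRadii P (coverSearch f r cs)
coverSearch-radii f r pr fr (c ∷ [])          = fr c
coverSearch-radii f r pr fr (c ∷ cs@(_ ∷ _)) = pr , fr c , coverSearch-radii f r pr fr cs

coverSearch-finds : ∀ {n k} (f : Vertex n → Tree n) r B →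
                    (∀ c v → dist c v ≤ r → Finds (f c) v B) →
                    (cs : Vec (Vertex n) (suc k)) → ∀ v (i : Fin (suc k)) →
                    dist (lookup cs i) v ≤ r → Finds (coverSearch f r cs) v (k + B)
coverSearch-finds f r B fnd (c ∷ []) v zero inside = fnd c v inside
coverSearch-finds {k = suc k} f r B fnd (c ∷ cs@(_ ∷ _)) v i inside =
  finds-query (f c) (coverSearch f r cs)
    (λ near → finds-weaken (m≤n+m B k) (fnd c v near)) (later i inside)
  where
    later : ∀ i → dist (lookup (c ∷ cs) i) v ≤ r → ¬ dist c v ≤ r →
            Finds (coverSearch f r cs) v (k + B)
    later zero     inside away = ⊥-elim (away inside)
    later (suc i′) inside _    = coverSearch-finds f r B fnd cs v i′ inside

splitFirst : ∀ {n} → List (Vertex (suc n)) → List (Vertex n) × List (Vertex n)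
splitFirst []               = [] , []
splitFirst ((false ∷ v) ∷ ys) = v ∷ proj₁ (splitFirst ys) , proj₂ (splitFirst ys)
splitFirst ((true  ∷ v) ∷ ys) = proj₁ (splitFirst ys) , v ∷ proj₂ (splitFirst ys)

splitFirst-length : ∀ {n} (ys : List (Vertex (suc n))) →
  length (proj₁ (splitFirst ys)) + length (proj₂ (splitFirst ys)) ≡ length ys
splitFirst-length []                 = refl
splitFirst-length ((false ∷ v) ∷ ys) = cong suc (splitFirst-length ys)
splitFirst-length ((true  ∷ v) ∷ ys) = trans (+-suc _ _) (cong suc (splitFirst-length ys))

splitFirst-false : ∀ {n} (ys : List (Vertex (suc n))) v → (false ∷ v) ∈ ys → v ∈ proj₁ (splitFirst ys)
splitFirst-false ((false ∷ v) ∷ ys) v (here refl) = here refl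
splitFirst-false ((false ∷ w) ∷ ys) v (there p)   = there (splitFirst-false ys v p)
splitFirst-false ((true  ∷ w) ∷ ys) v (there p)   = splitFirst-false ys v p

splitFirst-true : ∀ {n} (ys : List (Vertex (suc n))) v → (true ∷ v) ∈ ys → v ∈ proj₂ (splitFirst ys)
splitFirst-true ((true  ∷ v) ∷ ys) v (here refl) = here refl
splitFirst-true ((true  ∷ w) ∷ ys) v (there p)   = there (splitFirst-true ys v p)
splitFirst-true ((false ∷ w) ∷ ys) v (there p)   = splitFirst-true ys v p

2^n≤length : ∀ n (ys : List (Vertex n)) → (∀ v → v ∈ ys) → 2 ^ n ≤ length ys
2^n≤length zero    []       all with all []
... | ()
2^n≤length zero    (_ ∷ _)  _   = s≤s z≤n
2^n≤length (suc n) ys       all = begin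
    2 ^ n + (2 ^ n + 0)
      ≡⟨ cong (2 ^ n +_) (+-identityʳ _) ⟩
    2 ^ n + 2 ^ n
      ≤⟨ +-mono-≤ (2^n≤length n _ (λ v → splitFirst-false ys v (all _)))
                  (2^n≤length n _ (λ v → splitFirst-true ys v (all _))) ⟩
    length (proj₁ (splitFirst ys)) + length (proj₂ (splitFirst ys))
      ≡⟨ splitFirst-length ys ⟩
    length ys ∎
  where open ≤-Reasoning

outcomes : ∀ {n} → Tree n → ℕ → List (Vertex n)
outcomes (leaf w)          d       = w ∷ []
outcomes (query u ρ t₁ t₂) zero    = []
outcomes (query u ρ t₁ t₂) (suc d) = outcomes t₁ d ++ outcomes t₂ d

outcomes-length : ∀ {n} (t : Tree n) d → length (outcomes t d) ≤ 2 ^ d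
outcomes-length (leaf w)          d       = pow-pos 2 d (s≤s z≤n)
outcomes-length (query u ρ t₁ t₂) zero    = z≤n
outcomes-length (query u ρ t₁ t₂) (suc d) = begin
    length (outcomes t₁ d ++ outcomes t₂ d)
      ≡⟨ length-++ (outcomes t₁ d) ⟩
    length (outcomes t₁ d) + length (outcomes t₂ d)
      ≤⟨ +-mono-≤ (outcomes-length t₁ d) (outcomes-length t₂ d) ⟩
    2 ^ d + 2 ^ d
      ≡⟨ cong (2 ^ d +_) (sym (+-identityʳ _)) ⟩
    2 ^ suc d ∎
  where open ≤-Reasoning

outcomes-complete : ∀ {n} (t : Tree n) d v → cost t v ≤ d → run t v ∈ outcomes t d
outcomes-complete (leaf w) d v _ = here refl
outcomes-complete (query u ρ t₁ t₂) zero v c with dist u v ≤? ρ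
... | yes _ = ⊥-elim (n≮0 c)
... | no  _ = ⊥-elim (n≮0 c)
outcomes-complete (query u ρ t₁ t₂) (suc d) v c with dist u v ≤? ρ
... | yes _ = ∈-++⁺ˡ (outcomes-complete t₁ d v (≤-pred c))
... | no  _ = ∈-++⁺ʳ (outcomes t₁ d) (outcomes-complete t₂ d v (≤-pred c))

-- n ≤ a: all 2 ^ n vertices must be among the ≤ 2 ^ a outcomes.
solvable⇒n≤ : ∀ n {P : ℕ → Set} a → Solvable n P a → n ≤ a
solvable⇒n≤ n a (t , _ , ok) = subst (_≤ a) (⌈log₂2^n⌉≡n n) (⌈log₂⌉-least (2 ^ n) a 2^n≤2^a)
  where
    every : ∀ v → v ∈ outcomes t a
    every v = subst (_∈ outcomes t a) (proj₁ (ok v)) (outcomes-complete t a v (proj₂ (ok v)))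
    2^n≤2^a : 2 ^ n ≤ 2 ^ a
    2^n≤2^a = ≤-trans (2^n≤length n (outcomes t a) every) (outcomes-length t a)

-- The centres queried along the path of "no" answers, padded to length d.
noCentres : ∀ {n} → Tree n → (d : ℕ) → Vec (Vertex n) d
noCentres t                 zero    = []
noCentres {n} (leaf w)      (suc d) = origin n ∷ noCentres (leaf w) d
noCentres (query u ρ t₁ t₂) (suc d) = u ∷ noCentres t₂ d

noLeaf : ∀ {n} → Tree n → ℕ → Vertex n
noLeaf (leaf w)              d       = w
noLeaf {n} (query u ρ t₁ t₂) zero    = origin n
noLeaf (query u ρ t₁ t₂)     (suc d) = noLeaf t₂ d

no-path : ∀ {n} {P : ℕ → Set} r → (∀ {ρ} → P ρ → ρ ≤ r) → (t : Tree n) → AllRadii P t →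
          ∀ d v → cost t v ≤ d →
          (Σ (Fin d) λ i → dist (lookup (noCentres t d) i) v ≤ r) ⊎ run t v ≡ noLeaf t d
no-path r P⇒≤r (leaf w) _ d v _ = inj₂ refl
no-path r P⇒≤r (query u ρ t₁ t₂) _ zero v c with dist u v ≤? ρ
... | yes _ = ⊥-elim (n≮0 c)
... | no  _ = ⊥-elim (n≮0 c)
no-path r P⇒≤r (query u ρ t₁ t₂) (pρ , _ , a₂) (suc d) v c with dist u v ≤? ρ
... | yes inside = inj₁ (zero , ≤-trans inside (P⇒≤r pρ))
... | no  _ with no-path r P⇒≤r t₂ a₂ d v (≤-pred c)
...   | inj₁ (i , near) = inj₁ (suc i , near)
...   | inj₂ e          = inj₂ e

-- Hence a + 1 balls of radius r cover Q_n: the no-path balls and the leaf.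
solvable⇒cover : ∀ {n} {P : ℕ → Set} r → (∀ {ρ} → P ρ → ρ ≤ r) → ∀ a →
                 Solvable n P a → Covers n r (suc a)
solvable⇒cover r P⇒≤r a (t , radii , ok) = (noLeaf t a ∷ noCentres t a) , covered
  where
    covered : ∀ v → Σ (Fin (suc a)) λ i → InBall (lookup (noLeaf t a ∷ noCentres t a) i) r v
    covered v with no-path r P⇒≤r t radii a v (proj₂ (ok v))
    ... | inj₁ (i , near) = suc i , near
    ... | inj₂ e          = zero , subst (λ x → dist x v ≤ r) (trans (sym (proj₁ (ok v))) e)
                                       (subst (_≤ r) (sym (dist-self v)) z≤n)

cover-nonempty : ∀ {n r k} → Covers n r k → Σ ℕ λ k′ → k ≡ suc k′
cover-nonempty {n} {k = zero} (cs , covered) with covered (origin n)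
... | () , _
cover-nonempty {k = suc k} _ = k , refl

K∸1≤ : ∀ {n r k a} {P : ℕ → Set} → (∀ {ρ} → P ρ → ρ ≤ r) → IsK n r k → Solvable n P a → k ∸ 1 ≤ a
K∸1≤ {r = r} {a = a} P⇒≤r (_ , minimal) sol = ∸-monoˡ-≤ 1 (minimal (suc a) (solvable⇒cover r P⇒≤r a sol))

-- |B(c, r)| in Q_n, by recursion on the first coordinate of a vertex.
volume : ℕ → ℕ → ℕ
volume zero    r       = 1
volume (suc n) zero    = volume n zero
volume (suc n) (suc r) = volume n (suc r) + volume n r

volume-pos : ∀ n r → 1 ≤ volume n r
volume-pos zero    r       = ≤-refl
volume-pos (suc n) zero    = volume-pos n zero
volume-pos (suc n) (suc r) = ≤-trans (volume-pos n (suc r)) (m≤m+n _ _)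

partialSum : (ℕ → ℕ) → ℕ → ℕ
partialSum f zero    = f 0
partialSum f (suc r) = partialSum f r + f (suc r)

binomSum≡partialSum : ∀ n r → binomSum n r ≡ partialSum (n C_) r
binomSum≡partialSum n zero    = +-identityʳ (n C 0)
binomSum≡partialSum n (suc r) = begin
    sum (map (n C_) (upTo (suc (suc r))))
      ≡⟨ cong (λ xs → sum (map (n C_) xs)) (sym (applyUpTo-∷ʳ (λ x → x) (suc r))) ⟩
    sum (map (n C_) (upTo (suc r) ++ (suc r ∷ [])))
      ≡⟨ cong sum (map-++ (n C_) (upTo (suc r)) (suc r ∷ [])) ⟩
    sum (map (n C_) (upTo (suc r)) ++ (n C suc r ∷ []))
      ≡⟨ sum-++ (map (n C_) (upTo (suc r))) (n C suc r ∷ []) ⟩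
    binomSum n r + (n C suc r + 0)
      ≡⟨ cong₂ _+_ (binomSum≡partialSum n r) (+-identityʳ _) ⟩
    partialSum (n C_) r + n C suc r ∎
  where open ≡-Reasoning

-- Pascal's rule summed: the partial sums satisfy the recursion of volume.
partialSum-pascal : ∀ n r → partialSum (suc n C_) (suc r) ≡ partialSum (n C_) (suc r) + partialSum (n C_) r
partialSum-pascal n zero = begin
    1 + suc n C 1       ≡⟨ cong (1 +_) (sym (nCk+nC[k+1]≡[n+1]C[k+1] n 0)) ⟩
    1 + (1 + n C 1)     ≡⟨ +-comm 1 (1 + n C 1) ⟩
    1 + n C 1 + 1       ∎
  where open ≡-Reasoning
partialSum-pascal n (suc r) = begin
    partialSum (suc n C_) (suc r) + suc n C suc (suc r)
      ≡⟨ cong₂ _+_ (partialSum-pascal n r) (sym (nCk+nC[k+1]≡[n+1]C[k+1] n (suc r))) ⟩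
    (S + b) + S + (b + c)
      ≡⟨ regroup S b c ⟩
    S + b + c + (S + b) ∎
  where
    open ≡-Reasoning
    S = partialSum (n C_) r
    b = n C suc r
    c = n C suc (suc r)
    regroup : ∀ a b c → a + b + a + (b + c) ≡ a + b + c + (a + b)
    regroup = solve-∀

partialSum-0C : ∀ r → partialSum (0 C_) r ≡ 1
partialSum-0C zero    = refl
partialSum-0C (suc r) = trans (+-identityʳ _) (partialSum-0C r)

volume≡partialSum : ∀ n r → volume n r ≡ partialSum (n C_) r
volume≡partialSum zero    r       = sym (partialSum-0C r)
volume≡partialSum (suc n) zero    = volume≡partialSum n zero
volume≡partialSum (suc n) (suc r) =
  trans (cong₂ _+_ (volume≡partialSum n (suc r)) (volume≡partialSum n r)) (sym (partialSum-pascal n r))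

volume≡binomSum : ∀ n r → volume n r ≡ binomSum n r
volume≡binomSum n r = trans (volume≡partialSum n r) (sym (binomSum≡partialSum n r))

ballList : ∀ {n} → Vertex n → ℕ → List (Vertex n)
ballList []      r       = [] ∷ []
ballList (b ∷ c) zero    = map (b ∷_) (ballList c zero)
ballList (b ∷ c) (suc r) = map (b ∷_) (ballList c (suc r)) ++ map (not b ∷_) (ballList c r)

ballList-length : ∀ {n} (c : Vertex n) r → length (ballList c r) ≡ volume n r
ballList-length []      r       = refl
ballList-length (b ∷ c) zero    = trans (length-map (b ∷_) (ballList c zero)) (ballList-length c zero)
ballList-length {suc n} (b ∷ c) (suc r) = begin
    length (map (b ∷_) (ballList c (suc r)) ++ map (not b ∷_) (ballList c r))
      ≡⟨ length-++ (map (b ∷_) (ballList c (suc r))) ⟩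
    length (map (b ∷_) (ballList c (suc r))) + length (map (not b ∷_) (ballList c r))
      ≡⟨ cong₂ _+_ (trans (length-map _ (ballList c (suc r))) (ballList-length c (suc r)))
                   (trans (length-map _ (ballList c r)) (ballList-length c r)) ⟩
    volume n (suc r) + volume n r ∎
  where open ≡-Reasoning

ballList-complete : ∀ {n} (c : Vertex n) r v → dist c v ≤ r → v ∈ ballList c r
ballList-complete []          r       []          _ = here refl
ballList-complete (true  ∷ c) zero    (true  ∷ v) d = ∈-map⁺ (true  ∷_) (ballList-complete c zero v d)
ballList-complete (false ∷ c) zero    (false ∷ v) d = ∈-map⁺ (false ∷_) (ballList-complete c zero v d)
ballList-complete (true  ∷ c) zero    (false ∷ v) ()
ballList-complete (false ∷ c) zero    (true  ∷ v) ()
ballList-complete (true  ∷ c) (suc r) (true  ∷ v) d =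
  ∈-++⁺ˡ (∈-map⁺ (true ∷_) (ballList-complete c (suc r) v d))
ballList-complete (false ∷ c) (suc r) (false ∷ v) d =
  ∈-++⁺ˡ (∈-map⁺ (false ∷_) (ballList-complete c (suc r) v d))
ballList-complete (true  ∷ c) (suc r) (false ∷ v) (s≤s d) =
  ∈-++⁺ʳ (map (true ∷_) (ballList c (suc r))) (∈-map⁺ (false ∷_) (ballList-complete c r v d))
ballList-complete (false ∷ c) (suc r) (true  ∷ v) (s≤s d) =
  ∈-++⁺ʳ (map (false ∷_) (ballList c (suc r))) (∈-map⁺ (true ∷_) (ballList-complete c r v d))

coverList : ∀ {n k} → ℕ → Vec (Vertex n) k → List (Vertex n)
coverList r []       = []
coverList r (c ∷ cs) = ballList c r ++ coverList r cs

coverList-length : ∀ {n k} r (cs : Vec (Vertex n) k) → length (coverList r cs) ≡ k * volume n r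
coverList-length r []       = refl
coverList-length r (c ∷ cs) =
  trans (length-++ (ballList c r)) (cong₂ _+_ (ballList-length c r) (coverList-length r cs))

coverList-complete : ∀ {n k} r (cs : Vec (Vertex n) k) v (i : Fin k) →
                     dist (lookup cs i) v ≤ r → v ∈ coverList r cs
coverList-complete r (c ∷ cs) v zero    d = ∈-++⁺ˡ (ballList-complete c r v d)
coverList-complete r (c ∷ cs) v (suc i) d = ∈-++⁺ʳ (ballList c r) (coverList-complete r cs v i d)

-- The vertices of all balls of a cover, listed, are all of V(Q_n).
cover-volume : ∀ {n r k} → Covers n r k → 2 ^ n ≤ k * volume n r
cover-volume {n} {r} (cs , covered) = ≤-trans
  (2^n≤length n (coverList r cs) (λ v → coverList-complete r cs v (proj₁ (covered v)) (proj₂ (covered v))))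
  (≤-reflexive (coverList-length r cs))

-- Move away from x by flipping up to b of the coordinates where x and y agree.
flipAway : ∀ {n} → Vertex n → Vertex n → ℕ → Vertex n
flipAway []           []           b       = []
flipAway (true  ∷ xs) (true  ∷ ys) (suc b) = false ∷ flipAway xs ys b
flipAway (false ∷ xs) (false ∷ ys) (suc b) = true  ∷ flipAway xs ys b
flipAway (true  ∷ xs) (true  ∷ ys) zero    = true  ∷ flipAway xs ys zero
flipAway (false ∷ xs) (false ∷ ys) zero    = false ∷ flipAway xs ys zero
flipAway (true  ∷ xs) (false ∷ ys) b       = true  ∷ flipAway xs ys b
flipAway (false ∷ xs) (true  ∷ ys) b       = false ∷ flipAway xs ys b

-- Every flip also moves away from y: z = flipAway x y b lies "beyond" x seen from y.
flipAway-dist-y : ∀ {n} (x y : Vertex n) b →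
                  dist (flipAway x y b) y ≡ dist x y + dist (flipAway x y b) x
flipAway-dist-y []           []           b       = refl
flipAway-dist-y (true  ∷ xs) (true  ∷ ys) (suc b) = trans (cong suc (flipAway-dist-y xs ys b)) (sym (+-suc _ _))
flipAway-dist-y (false ∷ xs) (false ∷ ys) (suc b) = trans (cong suc (flipAway-dist-y xs ys b)) (sym (+-suc _ _))
flipAway-dist-y (true  ∷ xs) (true  ∷ ys) zero    = flipAway-dist-y xs ys zero
flipAway-dist-y (false ∷ xs) (false ∷ ys) zero    = flipAway-dist-y xs ys zero
flipAway-dist-y (true  ∷ xs) (false ∷ ys) b       = cong suc (flipAway-dist-y xs ys b)
flipAway-dist-y (false ∷ xs) (true  ∷ ys) b       = cong suc (flipAway-dist-y xs ys b)

flipAway-dist-x≤ : ∀ {n} (x y : Vertex n) b → dist (flipAway x y b) x ≤ b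
flipAway-dist-x≤ []           []           b       = z≤n
flipAway-dist-x≤ (true  ∷ xs) (true  ∷ ys) (suc b) = s≤s (flipAway-dist-x≤ xs ys b)
flipAway-dist-x≤ (false ∷ xs) (false ∷ ys) (suc b) = s≤s (flipAway-dist-x≤ xs ys b)
flipAway-dist-x≤ (true  ∷ xs) (true  ∷ ys) zero    = flipAway-dist-x≤ xs ys zero
flipAway-dist-x≤ (false ∷ xs) (false ∷ ys) zero    = flipAway-dist-x≤ xs ys zero
flipAway-dist-x≤ (true  ∷ xs) (false ∷ ys) b       = flipAway-dist-x≤ xs ys b
flipAway-dist-x≤ (false ∷ xs) (true  ∷ ys) b       = flipAway-dist-x≤ xs ys b

-- There are n - d(x, y) agreeing coordinates, so exactly b flips happen if b fits.
flipAway-dist-x≡ : ∀ {n} (x y : Vertex n) b → b + dist x y ≤ n → dist (flipAway x y b) x ≡ b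
flipAway-dist-x≡ []           []           zero    _       = refl
flipAway-dist-x≡ (true  ∷ xs) (true  ∷ ys) (suc b) (s≤s h) = cong suc (flipAway-dist-x≡ xs ys b h)
flipAway-dist-x≡ (false ∷ xs) (false ∷ ys) (suc b) (s≤s h) = cong suc (flipAway-dist-x≡ xs ys b h)
flipAway-dist-x≡ (true  ∷ xs) (true  ∷ ys) zero    _       = flipAway-dist-x≡ xs ys zero (dist≤n xs ys)
flipAway-dist-x≡ (false ∷ xs) (false ∷ ys) zero    _       = flipAway-dist-x≡ xs ys zero (dist≤n xs ys)
flipAway-dist-x≡ {suc n} (true  ∷ xs) (false ∷ ys) b h =
  flipAway-dist-x≡ xs ys b (≤-pred (subst (_≤ suc n) (+-suc b _) h))
flipAway-dist-x≡ {suc n} (false ∷ xs) (true  ∷ ys) b h =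
  flipAway-dist-x≡ xs ys b (≤-pred (subst (_≤ suc n) (+-suc b _) h))

-- The centre of a radius-r ball containing x but not y.
separator : ∀ {n} → ℕ → Vertex n → Vertex n → Vertex n
separator r x y = flipAway x y (suc r ∸ dist x y)

-- The separator is within r of x (as d(x, y) ≥ 1 flips suffice to reach r + 1 - d(x, y)) ...
separator-near : ∀ {n} r (x y : Vertex n) → x ≢ y → dist (separator r x y) x ≤ r
separator-near r x y x≢y = ≤-trans (flipAway-dist-x≤ x y _) (∸-monoʳ-≤ (suc r) (dist-pos x y x≢y))

-- ... but at distance r + 1 (or more, if d(x, y) > r) from y, as long as r < n.
separator-far : ∀ {n} r (x y : Vertex n) → r < n → r < dist (separator r x y) y
separator-far {n} r x y r<n with suc r ≤? dist x y
... | yes r<d = ≤-trans r<d (subst (dist x y ≤_) (sym (flipAway-dist-y x y _)) (m≤m+n _ _))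
... | no  r≮d = ≤-reflexive (sym (begin
      dist (separator r x y) y         ≡⟨ flipAway-dist-y x y _ ⟩
      dist x y + dist (separator r x y) x ≡⟨ cong (dist x y +_) (flipAway-dist-x≡ x y _ fits) ⟩
      dist x y + (suc r ∸ dist x y)    ≡⟨ m+[n∸m]≡n d≤1+r ⟩
      suc r                            ∎))
  where
    open ≡-Reasoning
    d≤1+r : dist x y ≤ suc r
    d≤1+r = <⇒≤ (≰⇒> r≮d)
    fits : (suc r ∸ dist x y) + dist x y ≤ n
    fits = subst (_≤ n) (sym (m∸n+n≡m d≤1+r)) r<n

Other : ∀ {n} → Vertex n → List (Vertex n) → Set
Other x S = (Σ (Vertex _) λ y → y ∈ S × x ≢ y) ⊎ (∀ z → z ∈ S → z ≡ x)

findOther : ∀ {n} (x : Vertex n) S → Other x S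
findOther x []      = inj₂ (λ z ())
findOther x (y ∷ S) with ≡-dec _≟ᵇ_ x y
... | no  x≢y = inj₁ (y , here refl , x≢y)
... | yes x≡y with findOther x S
...   | inj₁ (w , w∈S , x≢w) = inj₁ (w , there w∈S , x≢w)
...   | inj₂ all≡x          = inj₂ λ { z (here refl) → sym x≡y ; z (there z∈S) → all≡x z z∈S }

inBall? : ∀ {n} (u : Vertex n) r → Decidable (InBall u r)
inBall? u r s = dist u s ≤? r

outBall? : ∀ {n} (u : Vertex n) r → Decidable (λ s → ¬ InBall u r s)
outBall? u r s = ¬? (inBall? u r s)

-- While two candidates x ≠ y remain, query the ball of radius r around the
-- separator of x and y and keep the candidates consistent with the answer;
-- each query discards x or y.  The fuel f bounds the number of queries.
eliminate : ∀ {n} → ℕ → ℕ → List (Vertex n) → Tree n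
eliminate {n} r f       []      = leaf (origin n)
eliminate     r f       (x ∷ S) with findOther x S
... | inj₂ _           = leaf x
... | inj₁ (y , _ , _) with f
...   | zero   = leaf x
...   | suc f′ = query u r (eliminate r f′ (filter (inBall? u r) (x ∷ S)))
                           (eliminate r f′ (filter (outBall? u r) (x ∷ S)))
  where u = separator r x y

eliminate-radii : ∀ {n} r f (S : List (Vertex n)) → AllRadii (_≡ r) (eliminate r f S)
eliminate-radii r f       []      = tt
eliminate-radii r f       (x ∷ S) with findOther x S
... | inj₂ _           = tt
... | inj₁ (y , _ , _) with f
...   | zero   = tt
...   | suc f′ = refl , eliminate-radii r f′ (filter (inBall? u r) (x ∷ S))
                      , eliminate-radii r f′ (filter (outBall? u r) (x ∷ S))
  where u = separator r x y

nonempty : ∀ {A : Set} {v : A} {S} → v ∈ S → 1 ≤ length S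
nonempty {S = _ ∷ _} _ = s≤s z≤n

-- Starting from candidates S ∋ v, with enough fuel, v is found with |S| - 1 queries:
-- every query keeps v and discards one of x, y.
eliminate-finds : ∀ {n} r → r < n → ∀ f (S : List (Vertex n)) v → v ∈ S → length S ≤ suc f →
                  Finds (eliminate r f S) v (length S ∸ 1)
eliminate-finds r r<n f (x ∷ S) v v∈ fuel with findOther x S
... | inj₂ all≡x = finds (sym (only v∈)) z≤n
  where
    only : v ∈ x ∷ S → v ≡ x
    only (here v≡x)  = v≡x
    only (there v∈S) = all≡x v v∈S
... | inj₁ (y , y∈S , x≢y) with f
...   | zero   = ⊥-elim (<⇒≱ (s≤s (nonempty y∈S)) fuel)
...   | suc f′ = finds-weaken (≤-reflexive (m+[n∸m]≡n (nonempty y∈S)))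
                   (finds-query _ _
                     (λ inside  → branch (inBall? u r) inside (there y∈S) (<⇒≱ (separator-far r x y r<n)))
                     (λ outside → branch (outBall? u r) outside (here refl)
                                         (λ out → out (separator-near r x y x≢y))))
  where
    u = separator r x y
    branch : ∀ {P : Vertex _ → Set} (P? : Decidable P) → P v → ∀ {z} → z ∈ x ∷ S → ¬ P z →
             Finds (eliminate r f′ (filter P? (x ∷ S))) v (length S ∸ 1)
    branch P? Pv z∈ ¬Pz = finds-weaken (∸-monoˡ-≤ 1 (≤-pred shorter))
      (eliminate-finds r r<n f′ _ v (∈-filter⁺ P? v∈ Pv) (≤-pred (≤-trans shorter fuel)))
      where
        shorter : length (filter P? (x ∷ S)) < length (x ∷ S)
        shorter = filter-notAll P? (x ∷ S) (Any.map (λ { refl → ¬Pz }) z∈)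

strategy : ∀ {n} {P : ℕ → Set} {d} (t : Tree n) → AllRadii P t → (∀ v → Finds t v d) → Solvable n P d
strategy t radii fnd = t , radii , λ v → Finds.found (fnd v) , Finds.within (fnd v)

cover⇒strategy : ∀ {n r k B} {P : ℕ → Set} → Covers n r (suc k) → P r →
                 (f : Vertex n → Tree n) → (∀ c → AllRadii P (f c)) →
                 (∀ c v → dist c v ≤ r → Finds (f c) v B) → Solvable n P (k + B)
cover⇒strategy {r = r} {B = B} (cs , covered) pr f radii fnd =
  strategy (coverSearch f r cs) (coverSearch-radii f r pr radii cs)
           (λ v → coverSearch-finds f r B fnd cs v (proj₁ (covered v)) (proj₂ (covered v)))

-- (i)  n ≤ A(Q_n) ≤ n - 1 + ⌈log₂ (n+1)⌉: B(0, n) is everything.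
A-bounds : ∀ n a → IsA n a → n ≤ a × a ≤ (n ∸ 1) + ⌈log₂ (suc n) ⌉
A-bounds n a (sol , minimal) = solvable⇒n≤ n a sol , subst (a ≤_) (+-comm _ (n ∸ 1)) (minimal _ whole-cube)
  where
    whole-cube : Solvable n AnyRadius (⌈log₂ (suc n) ⌉ + (n ∸ 1))
    whole-cube = strategy (locate (origin n) n) (AllRadii-any _)
                          (λ v → locate-finds (origin n) n v (dist≤n (origin n) v))

A≤-bounds : ∀ n r k a → IsK n r k → IsA≤ n r a → k ∸ 1 ≤ a × a ≤ k + (n ∸ 1) + ⌈log₂ (suc r) ⌉
A≤-bounds n r k a isK@(cover , _) (sol , minimal) = K∸1≤ (λ ρ≤r → ρ≤r) isK sol , upper (cover-nonempty cover) cover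
  where
    upper : Σ ℕ (λ k′ → k ≡ suc k′) → Covers n r k → a ≤ k + (n ∸ 1) + ⌈log₂ (suc r) ⌉
    upper (k′ , refl) cover = ≤-trans
      (minimal _ (cover⇒strategy cover ≤-refl (λ c → locate c r) (λ c → locate-radii c r)
                                 (λ c v → locate-finds c r v)))
      (≤-trans (≤-reflexive (rearrange k′ ⌈log₂ (suc r) ⌉ (n ∸ 1))) (n≤1+n _))
      where
        rearrange : ∀ k L m → k + (L + m) ≡ k + m + L
        rearrange = solve-∀

A=-bounds : ∀ n r → r < n → ∀ k a → IsK n r k → IsA= n r a → k ∸ 1 ≤ a × a ≤ k + binomSum n r
A=-bounds n r r<n k a isK@(cover , _) (sol , minimal) =
  K∸1≤ ≤-reflexive isK sol , upper (cover-nonempty cover) cover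
  where
    inside : Vertex n → Tree n
    inside c = eliminate r (volume n r) (ballList c r)
    inside-finds : ∀ c v → dist c v ≤ r → Finds (inside c) v (binomSum n r)
    inside-finds c v near = finds-weaken
      (≤-trans (m∸n≤m _ 1) (≤-reflexive (trans (ballList-length c r) (volume≡binomSum n r))))
      (eliminate-finds r r<n (volume n r) (ballList c r) v (ballList-complete c r v near)
                       (≤-trans (≤-reflexive (ballList-length c r)) (n≤1+n _)))
    upper : Σ ℕ (λ k′ → k ≡ suc k′) → Covers n r k → a ≤ k + binomSum n r
    upper (k′ , refl) cover = ≤-trans
      (minimal _ (cover⇒strategy cover refl inside (λ c → eliminate-radii r (volume n r) (ballList c r))
                                 inside-finds))
      (n≤1+n _)

-- Chernoff-type bound: for p ≤ q,  V(n, r) p^r q^n ≤ q^r (p + q)^n,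
-- i.e. V(n, r) ≤ (q/p)^r ((p+q)/q)^n.  Induction along volume's recursion.
chernoff : ∀ p q → p ≤ q → ∀ n r → volume n r * p ^ r * q ^ n ≤ q ^ r * (p + q) ^ n
chernoff p q p≤q zero r =
  subst₂ _≤_ (sym (trans (*-identityʳ _) (*-identityˡ _))) (sym (*-identityʳ _)) (^-monoˡ-≤ r p≤q)
chernoff p q p≤q (suc n) zero = begin
    volume n 0 * 1 * (q * q ^ n)      ≡⟨ shuffle (volume n 0) q (q ^ n) ⟩
    q * (volume n 0 * 1 * q ^ n)      ≤⟨ *-mono-≤ (m≤n+m q p) (chernoff p q p≤q n zero) ⟩
    (p + q) * (1 * (p + q) ^ n)       ≡⟨ cong ((p + q) *_) (*-identityˡ _) ⟩
    (p + q) * (p + q) ^ n             ≡⟨ sym (*-identityˡ _) ⟩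
    1 * ((p + q) * (p + q) ^ n)       ∎
  where
    open ≤-Reasoning
    shuffle : ∀ a b c → a * 1 * (b * c) ≡ b * (a * 1 * c)
    shuffle = solve-∀
chernoff p q p≤q (suc n) (suc r) = begin
    (volume n (suc r) + volume n r) * (p * p ^ r) * (q * q ^ n)
      ≡⟨ split (volume n (suc r)) (volume n r) p q (p ^ r) (q ^ n) ⟩
    q * (volume n (suc r) * (p * p ^ r) * q ^ n) + p * q * (volume n r * p ^ r * q ^ n)
      ≤⟨ +-mono-≤ (*-monoʳ-≤ q (chernoff p q p≤q n (suc r))) (*-monoʳ-≤ (p * q) (chernoff p q p≤q n r)) ⟩
    q * (q * q ^ r * (p + q) ^ n) + p * q * (q ^ r * (p + q) ^ n)
      ≡⟨ merge p q (q ^ r) ((p + q) ^ n) ⟩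
    q * q ^ r * ((p + q) * (p + q) ^ n) ∎
  where
    open ≤-Reasoning
    split : ∀ a b p q x y → (a + b) * (p * x) * (q * y) ≡ q * (a * (p * x) * y) + p * q * (b * x * y)
    split = solve-∀
    merge : ∀ p q x y → q * (q * x * y) + p * q * (x * y) ≡ q * x * ((p + q) * y)
    merge = solve-∀

n*A^n≤A*[1+A]^n : ∀ A n → n * A ^ n ≤ A * suc A ^ n
n*A^n≤A*[1+A]^n A zero    = z≤n
n*A^n≤A*[1+A]^n A (suc n) = begin
    A ^ suc n + n * A ^ suc n             ≡⟨ shuffle A n (A ^ n) ⟩
    A * A ^ n + A * (n * A ^ n)           ≤⟨ +-mono-≤ (*-monoʳ-≤ A (^-monoˡ-≤ n (n≤1+n A)))
                                                      (*-monoʳ-≤ A (n*A^n≤A*[1+A]^n A n)) ⟩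
    A * suc A ^ n + A * (A * suc A ^ n)   ≡⟨ collect A (suc A ^ n) ⟩
    A * (suc A * suc A ^ n)               ∎
  where
    open ≤-Reasoning
    shuffle : ∀ A n x → A * x + n * (A * x) ≡ A * x + A * (n * x)
    shuffle = solve-∀
    collect : ∀ A y → A * y + A * (A * y) ≡ A * ((1 + A) * y)
    collect = solve-∀

c*A^n≤B^n : ∀ A B c n → 1 ≤ A → A < B → c * A ≤ n → c * A ^ n ≤ B ^ n
c*A^n≤B^n A B c n 1≤A A<B cA≤n = *-cancelʳ-≤′ (c * A ^ n) (B ^ n) A 1≤A (begin
    c * A ^ n * A   ≡⟨ shuffle c (A ^ n) A ⟩
    c * A * A ^ n   ≤⟨ *-monoˡ-≤ (A ^ n) cA≤n ⟩
    n * A ^ n       ≤⟨ n*A^n≤A*[1+A]^n A n ⟩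
    A * suc A ^ n   ≤⟨ *-monoʳ-≤ A (^-monoˡ-≤ n A<B) ⟩
    A * B ^ n       ≡⟨ *-comm A _ ⟩
    B ^ n * A       ∎)
  where
    open ≤-Reasoning
    shuffle : ∀ c x A → c * x * A ≡ c * A * x
    shuffle = solve-∀

-- Bernoulli: (1 + 1/s)^k ≥ 1 + k/s, in the form s^k s + k s^k ≤ (s+1)^k s.
bernoulli : ∀ s k → s ^ k * s + k * s ^ k ≤ suc s ^ k * s
bernoulli s zero    = ≤-reflexive (+-identityʳ _)
bernoulli s (suc k) = begin
    s * s ^ k * s + suc k * (s * s ^ k)
      ≤⟨ m≤m+n _ (k * s ^ k) ⟩
    s * s ^ k * s + suc k * (s * s ^ k) + k * s ^ k
      ≡⟨ factor s (s ^ k) k ⟩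
    suc s * (s ^ k * s + k * s ^ k)
      ≤⟨ *-monoʳ-≤ (suc s) (bernoulli s k) ⟩
    suc s * (suc s ^ k * s)
      ≡⟨ *-assoc (suc s) (suc s ^ k) s ⟨
    suc s ^ suc k * s ∎
  where
    open ≤-Reasoning
    factor : ∀ s x k → s * x * s + suc k * (s * x) + k * x ≡ suc s * (x * s + k * x)
    factor = solve-∀

-- (1 + 1/s)^(s+1) ≥ 2.
2*s^[1+s]≤[1+s]^[1+s] : ∀ s → 2 * s ^ suc s ≤ suc s ^ suc s
2*s^[1+s]≤[1+s]^[1+s] zero        = z≤n
2*s^[1+s]≤[1+s]^[1+s] s@(suc _) = *-cancelʳ-≤′ _ _ s (s≤s z≤n) (begin
    2 * s ^ suc s * s                     ≤⟨ m≤m+n _ (s ^ suc s) ⟩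
    2 * s ^ suc s * s + s ^ suc s         ≡⟨ shuffle (s ^ suc s) s ⟩
    s ^ suc s * s + suc s * s ^ suc s     ≤⟨ bernoulli s (suc s) ⟩
    suc s ^ suc s * s                     ∎)
  where
    open ≤-Reasoning
    shuffle : ∀ x s → 2 * x * s + x ≡ x * s + suc s * x
    shuffle = solve-∀

-- Hence (1 + 1/s)^t ≥ 2^b whenever (s+1) b ≤ t: s^t 2^b ≤ (s+1)^t.
s^t*2^b≤[1+s]^t : ∀ s b t → suc s * b ≤ t → s ^ t * 2 ^ b ≤ suc s ^ t
s^t*2^b≤[1+s]^t s b t h = subst (λ t → s ^ t * 2 ^ b ≤ suc s ^ t) (m+[n∸m]≡n h) (blocks b (t ∸ suc s * b))
  where
    open ≤-Reasoning
    -- each block of s + 1 exponents contributes a factor 2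
    blocks : ∀ b e → s ^ (suc s * b + e) * 2 ^ b ≤ suc s ^ (suc s * b + e)
    blocks zero    e = ≤-trans (≤-reflexive (*-identityʳ _)) (^-monoˡ-≤ (suc s * 0 + e) (n≤1+n s))
    blocks (suc b) e = begin
        s ^ E′ * (2 * 2 ^ b)                          ≡⟨ cong (λ x → s ^ x * (2 * 2 ^ b)) E′≡ ⟩
        s ^ (suc s + E) * (2 * 2 ^ b)                 ≡⟨ cong (_* (2 * 2 ^ b)) (^-distribˡ-+-* s (suc s) E) ⟩
        s ^ suc s * s ^ E * (2 * 2 ^ b)               ≡⟨ shuffle (s ^ suc s) (s ^ E) (2 ^ b) ⟩
        (2 * s ^ suc s) * (s ^ E * 2 ^ b)             ≤⟨ *-mono-≤ (2*s^[1+s]≤[1+s]^[1+s] s) (blocks b e) ⟩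
        suc s ^ suc s * suc s ^ E                     ≡⟨ ^-distribˡ-+-* (suc s) (suc s) E ⟨
        suc s ^ (suc s + E)                           ≡⟨ cong (suc s ^_) E′≡ ⟨
        suc s ^ E′                                    ∎
      where
        E  = suc s * b + e
        E′ = suc s * suc b + e
        E′≡ : E′ ≡ suc s + E
        E′≡ = regroup s b e
          where regroup : ∀ s b e → suc s * suc b + e ≡ suc s + (suc s * b + e)
                regroup = solve-∀
        shuffle : ∀ x y z → x * y * (2 * z) ≡ (2 * x) * (y * z)
        shuffle = solve-∀

-- (j+d+1)^j d ≤ (j+d)^(j+1), i.e. (1 + 1/(j+d))^j ≤ (j+d)/d.
[1+j+d]^j*d≤[j+d]^[1+j] : ∀ j d → suc (j + d) ^ j * d ≤ (j + d) ^ suc j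
[1+j+d]^j*d≤[j+d]^[1+j] zero    d = ≤-reflexive (trans (*-identityˡ d) (sym (*-identityʳ d)))
[1+j+d]^j*d≤[j+d]^[1+j] (suc j) d = begin
    suc M ^ suc j * d                   ≡⟨ shuffle (suc M) (suc M ^ j) d ⟩
    suc M ^ j * (suc M * d)             ≤⟨ *-monoʳ-≤ (suc M ^ j) key ⟩
    suc M ^ j * (suc d * M)             ≡⟨ *-assoc (suc M ^ j) (suc d) M ⟨
    suc M ^ j * suc d * M               ≡⟨ cong (λ x → suc x ^ j * suc d * M) (sym (+-suc j d)) ⟩
    suc (j + suc d) ^ j * suc d * M     ≤⟨ *-monoˡ-≤ M ([1+j+d]^j*d≤[j+d]^[1+j] j (suc d)) ⟩
    (j + suc d) ^ suc j * M             ≡⟨ cong (λ x → x ^ suc j * M) (+-suc j d) ⟩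
    M ^ suc j * M                       ≡⟨ *-comm (M ^ suc j) M ⟩
    M ^ suc (suc j)                     ∎
  where
    open ≤-Reasoning
    M = suc j + d
    shuffle : ∀ a x d → a * x * d ≡ x * (a * d)
    shuffle = solve-∀
    key : suc M * d ≤ suc d * M
    key = subst (_≤ suc d * M) (*-comm d (suc M)) (begin
      d * suc M    ≡⟨ *-suc d M ⟩
      d + d * M    ≤⟨ +-monoˡ-≤ (d * M) (m≤n+m d (suc j)) ⟩
      M + d * M    ∎)

-- (1 + 1/M)^r ≤ 2 when 2 r ≤ M: (M+1)^r ≤ 2 M^r.
[1+M]^r≤2*M^r : ∀ r M → 2 * r ≤ M → suc M ^ r ≤ 2 * M ^ r
[1+M]^r≤2*M^r zero    zero    _  = s≤s z≤n
[1+M]^r≤2*M^r (suc r) zero    ()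
[1+M]^r≤2*M^r r M@(suc _) 2r≤M = *-cancelʳ-≤′ _ _ M (s≤s z≤n) (begin
    suc M ^ r * M                 ≤⟨ *-monoʳ-≤ (suc M ^ r) M≤2d ⟩
    suc M ^ r * (2 * d)           ≡⟨ shuffle (suc M ^ r) d ⟩
    2 * (suc M ^ r * d)           ≡⟨ cong (λ x → 2 * (suc x ^ r * d)) (sym r+d≡M) ⟩
    2 * (suc (r + d) ^ r * d)     ≤⟨ *-monoʳ-≤ 2 ([1+j+d]^j*d≤[j+d]^[1+j] r d) ⟩
    2 * (r + d) ^ suc r           ≡⟨ cong (λ x → 2 * x ^ suc r) r+d≡M ⟩
    2 * (M * M ^ r)               ≡⟨ shuffle′ M (M ^ r) ⟩
    2 * M ^ r * M                 ∎)
  where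
    open ≤-Reasoning
    d = M ∸ r
    r≤M : r ≤ M
    r≤M = ≤-trans (m≤m+n r (r + 0)) 2r≤M
    r+d≡M : r + d ≡ M
    r+d≡M = m+[n∸m]≡n r≤M
    M≤2d : M ≤ 2 * d
    M≤2d = +-cancelʳ-≤ (2 * r) M (2 * d) (begin
      M + 2 * r           ≤⟨ +-monoʳ-≤ M 2r≤M ⟩
      M + M               ≡⟨ cong (λ x → x + x) (sym (m∸n+n≡m r≤M)) ⟩
      (d + r) + (d + r)   ≡⟨ double d r ⟩
      2 * d + 2 * r       ∎)
      where double : ∀ d r → (d + r) + (d + r) ≡ 2 * d + 2 * r
            double = solve-∀
    shuffle : ∀ x d → x * (2 * d) ≡ 2 * (x * d)
    shuffle = solve-∀
    shuffle′ : ∀ M x → 2 * (M * x) ≡ 2 * x * M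
    shuffle′ = solve-∀

-- If K - 1 ≤ A ≤ K + E where the error E is at most K/(m+1) and K ≥ m + 2,
-- then A and K agree up to the factor (m+2)/(m+1).
ratio-bounds : ∀ m k a E → k ∸ 1 ≤ a → a ≤ k + E → suc m * E ≤ k → suc (suc m) ≤ k →
               suc m * a ≤ suc (suc m) * k × suc m * k ≤ suc (suc m) * a
ratio-bounds m zero    a E _   _   _    ()
ratio-bounds m (suc k) a E k≤a a≤K+E mE≤K 2+m≤K = upper , lower
  where
    open ≤-Reasoning
    upper : suc m * a ≤ suc (suc m) * suc k
    upper = begin
      suc m * a                   ≤⟨ *-monoʳ-≤ (suc m) a≤K+E ⟩
      suc m * (suc k + E)         ≡⟨ *-distribˡ-+ (suc m) (suc k) E ⟩
      suc m * suc k + suc m * E   ≤⟨ +-monoʳ-≤ (suc m * suc k) mE≤K ⟩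
      suc m * suc k + suc k       ≡⟨ +-comm (suc m * suc k) (suc k) ⟩
      suc (suc m) * suc k         ∎
    lower : suc m * suc k ≤ suc (suc m) * a
    lower = begin
      suc m * suc k               ≡⟨ *-suc (suc m) k ⟩
      suc m + suc m * k           ≤⟨ +-monoˡ-≤ (suc m * k) (≤-pred 2+m≤K) ⟩
      suc (suc m) * k             ≤⟨ *-monoʳ-≤ (suc (suc m)) k≤a ⟩
      suc (suc m) * a             ∎

-- Dividing a cover bound by the volume: c V^2 ≤ 2^n ≤ K V gives c V ≤ K.
K-from-volume : ∀ {n r k} c → IsK n r k → c * volume n r * volume n r ≤ 2 ^ n → c * volume n r ≤ k
K-from-volume {n} {r} c (cover , _) cV²≤2^n =
  *-cancelʳ-≤′ _ _ (volume n r) (volume-pos n r) (≤-trans cV²≤2^n (cover-volume cover))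

-- The constant 2 · 289^4 < 512^4 of the small-radius regime; opaque, so that
-- the large literal is never unfolded during type checking.
opaque
  A₃ : ℕ
  A₃ = 2 * 289 ^ 4

  A₃-def : A₃ ≡ 2 * 289 ^ 4
  A₃-def = refl

  A₃-pos : 1 ≤ A₃
  A₃-pos = ≤ᵇ⇒≤ 1 (2 * 289 ^ 4) tt

  A₃<512^4 : A₃ < 512 ^ 4
  A₃<512^4 = ≤ᵇ⇒≤ (suc (2 * 289 ^ 4)) (512 ^ 4) tt

-- For 32 r ≤ n and n ≥ c^4 A₃:  c 256^r 289^n ≤ 512^n.  Raise to the 4th power:
-- 256^(4r) ≤ 2^n and c^4 (2 · 289^4)^n ≤ (512^4)^n.
c*256^r*289^n≤512^n : ∀ c n r → 32 * r ≤ n → c ^ 4 * A₃ ≤ n → c * 256 ^ r * 289 ^ n ≤ 2 ^ n * 256 ^ n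
c*256^r*289^n≤512^n c n r 32r≤n large = pow-cancel-≤ 3 _ _ (begin
    (c * 256 ^ r * 289 ^ n) ^ 4
      ≡⟨ ^-distribʳ-* (c * 256 ^ r) (289 ^ n) 4 ⟩
    (c * 256 ^ r) ^ 4 * (289 ^ n) ^ 4
      ≡⟨ cong₂ _*_ (^-distribʳ-* c (256 ^ r) 4) (swap-exponents 289 n 4) ⟩
    c ^ 4 * (256 ^ r) ^ 4 * (289 ^ 4) ^ n
      ≡⟨ cong (λ x → c ^ 4 * x * (289 ^ 4) ^ n) (trans (swap-exponents 256 r 4) (^-*-assoc 2 32 r)) ⟩
    c ^ 4 * 2 ^ (32 * r) * (289 ^ 4) ^ n
      ≤⟨ *-monoˡ-≤ ((289 ^ 4) ^ n) (*-monoʳ-≤ (c ^ 4) (^-monoʳ-≤ 2 32r≤n)) ⟩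
    c ^ 4 * 2 ^ n * (289 ^ 4) ^ n
      ≡⟨ *-assoc (c ^ 4) (2 ^ n) _ ⟩
    c ^ 4 * (2 ^ n * (289 ^ 4) ^ n)
      ≡⟨ cong (c ^ 4 *_) (trans (cong (_^ n) A₃-def) (^-distribʳ-* 2 (289 ^ 4) n)) ⟨
    c ^ 4 * A₃ ^ n
      ≤⟨ c*A^n≤B^n A₃ (512 ^ 4) (c ^ 4) n A₃-pos A₃<512^4 large ⟩
    (512 ^ 4) ^ n
      ≡⟨ swap-exponents 512 n 4 ⟨
    (512 ^ n) ^ 4
      ≡⟨ cong (_^ 4) (^-distribʳ-* 2 256 n) ⟩
    (2 ^ n * 256 ^ n) ^ 4 ∎)
  where
    open ≤-Reasoning
    swap-exponents : ∀ x a b → (x ^ a) ^ b ≡ (x ^ b) ^ a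
    swap-exponents x a b = trans (^-*-assoc x a b) (trans (cong (x ^_) (*-comm a b)) (sym (^-*-assoc x b a)))

-- Small balls (32 r ≤ n) are tiny: c V(n, r)^2 ≤ 2^n for n ≥ c^4 A₃.
-- Chernoff with p/q = 1/16 gives V ≤ 16^r (17/16)^n; square and compare.
small-radius-volume : ∀ c n r → 32 * r ≤ n → c ^ 4 * A₃ ≤ n → c * volume n r * volume n r ≤ 2 ^ n
small-radius-volume c n r 32r≤n large =
  *-cancelʳ-≤′ _ _ (256 ^ n) (pow-pos 256 n (s≤s z≤n)) (begin
    c * V * V * 256 ^ n                         ≡⟨ cong (c * V * V *_) (^-distribʳ-* 16 16 n) ⟩
    c * V * V * (16 ^ n * 16 ^ n)               ≡⟨ pair c V (16 ^ n) ⟩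
    c * ((V * 16 ^ n) * (V * 16 ^ n))           ≤⟨ *-monoʳ-≤ c (*-mono-≤ V16^n V16^n) ⟩
    c * ((16 ^ r * 17 ^ n) * (16 ^ r * 17 ^ n)) ≡⟨ unpair c (16 ^ r) (17 ^ n) ⟩
    c * (16 ^ r * 16 ^ r) * (17 ^ n * 17 ^ n)   ≡⟨ cong₂ (λ x y → c * x * y) (^-distribʳ-* 16 16 r)
                                                                         (^-distribʳ-* 17 17 n) ⟨
    c * 256 ^ r * 289 ^ n                       ≤⟨ c*256^r*289^n≤512^n c n r 32r≤n large ⟩
    2 ^ n * 256 ^ n                             ∎)
  where
    open ≤-Reasoning
    V = volume n r
    V16^n : V * 16 ^ n ≤ 16 ^ r * 17 ^ n
    V16^n = subst (λ x → x * 16 ^ n ≤ 16 ^ r * 17 ^ n) (*-identityʳ V)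
              (subst (λ x → V * x * 16 ^ n ≤ 16 ^ r * 17 ^ n) (^-zeroˡ r) (chernoff 1 16 (s≤s z≤n) n r))
    pair : ∀ c X y → c * X * X * (y * y) ≡ c * ((X * y) * (X * y))
    pair = solve-∀
    unpair : ∀ c x y → c * ((x * y) * (x * y)) ≡ c * (x * x) * (y * y)
    unpair = solve-∀

-- (iii) asymptotics: for 32 r ≤ n and n ≥ (m+2)^4 A₃ the error term
-- V(n, r) of (iii) is at most K(n, r)/(m+2).
A=-asymptotic : ∀ m n r → suc (suc m) ^ 4 * A₃ ≤ n → r < n → 32 * r ≤ n →
                ∀ k a → IsK n r k → IsA= n r a →
                suc m * a ≤ suc (suc m) * k × suc m * k ≤ suc (suc m) * a
A=-asymptotic m n r large r<n 32r≤n k a isK isA =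
  ratio-bounds m k a V (proj₁ bounds) a≤k+V (≤-trans (*-monoˡ-≤ V (n≤1+n (suc m))) cV≤k) c≤k
  where
    c = suc (suc m)
    V = volume n r
    bounds = A=-bounds n r r<n k a isK isA
    a≤k+V : a ≤ k + V
    a≤k+V = subst (λ x → a ≤ k + x) (sym (volume≡binomSum n r)) (proj₂ bounds)
    cV≤k : c * V ≤ k
    cV≤k = K-from-volume c isK (small-radius-volume c n r 32r≤n large)
    c≤k : c ≤ k
    c≤k = ≤-trans (subst (_≤ c * V) (*-identityʳ c) (*-monoʳ-≤ c (volume-pos n r))) cV≤k

halving : ∀ x → 2 * ⌊ x /2⌋ ≤ x × x ≤ suc (2 * ⌊ x /2⌋)
halving zero          = z≤n , z≤n
halving (suc zero)    = z≤n , ≤-refl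
halving (suc (suc x)) = subst (_≤ suc (suc x)) (sym two-more) (s≤s (s≤s (proj₁ (halving x))))
                      , subst (suc (suc x) ≤_) (sym (cong suc two-more)) (s≤s (s≤s (proj₂ (halving x))))
  where
    two-more : 2 * suc ⌊ x /2⌋ ≡ suc (suc (2 * ⌊ x /2⌋))
    two-more = *-suc 2 ⌊ x /2⌋

-- A power of two s with n ≤ s^2 ≤ 8 n: take s = 2 · 2^⌊⌈log₂ n⌉/2⌋.
square-between : ∀ n → 1 ≤ n → Σ ℕ λ s → 1 ≤ s × n ≤ s * s × s * s ≤ 8 * n
square-between n 1≤n = s , ≤-trans (pow-pos 2 h (s≤s z≤n)) (m≤m+n _ _) , n≤s² , s²≤8n
  where
    open ≤-Reasoning
    Λ = ⌈log₂ n ⌉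
    h = ⌊ Λ /2⌋
    s = 2 * 2 ^ h
    s²≡ : s * s ≡ 4 * 2 ^ (2 * h)
    s²≡ = trans (square (2 ^ h)) (cong (4 *_) (trans (sym (^-distribˡ-+-* 2 h h))
                                                  (cong (λ x → 2 ^ (h + x)) (sym (+-identityʳ h)))))
      where square : ∀ y → 2 * y * (2 * y) ≡ 4 * (y * y)
            square = solve-∀
    n≤s² : n ≤ s * s
    n≤s² = begin
      n                 ≤⟨ ≤2^⌈log₂⌉ n ⟩
      2 ^ Λ             ≤⟨ ^-monoʳ-≤ 2 (proj₂ (halving Λ)) ⟩
      2 * 2 ^ (2 * h)   ≤⟨ *-monoˡ-≤ (2 ^ (2 * h)) (s≤s (s≤s (z≤n {2}))) ⟩
      4 * 2 ^ (2 * h)   ≡⟨ s²≡ ⟨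
      s * s             ∎
    s²≤8n : s * s ≤ 8 * n
    s²≤8n = begin
      s * s             ≡⟨ s²≡ ⟩
      4 * 2 ^ (2 * h)   ≤⟨ *-monoʳ-≤ 4 (^-monoʳ-≤ 2 (proj₁ (halving Λ))) ⟩
      4 * 2 ^ Λ         ≤⟨ *-monoʳ-≤ 4 (2^⌈log₂⌉≤2*m n 1≤n) ⟩
      4 * (2 * n)       ≡⟨ *-assoc 4 2 n ⟨
      8 * n             ∎

-- Chernoff with p/q = s/(s+1) gives
-- V ≤ ((2s+1)^2/(s(s+1)))^r ((2s+1)/(s+1))^t, and (2s+1)^2 = 4 s(s+1) + 1
-- with (1 + 1/(4s(s+1)))^r ≤ 2.
volume-near-half-factor : ∀ s r t → 1 ≤ s → 2 * r ≤ 4 * suc s * s →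
                          volume (2 * r + t) r * suc s ^ t ≤ 2 * 4 ^ r * (s + suc s) ^ t
volume-near-half-factor s r t 1≤s 2r≤M = *-cancelʳ-≤′ _ _ (P * Q * Q) PQQ-pos (begin
    X * T * (P * Q * Q)             ≡⟨ shuffle X T P Q ⟩
    X * P * (Q * Q * T)             ≡⟨ cong (X * P *_) (sym (trans (^-distribˡ-+-* (suc s) (2 * r) t)
                                          (cong (_* T) (trans (double-exponent (suc s))
                                                               (^-distribʳ-* (suc s) (suc s) r))))) ⟩
    X * P * suc s ^ (2 * r + t)     ≤⟨ chernoff s (suc s) (n≤1+n s) (2 * r + t) r ⟩
    Q * S ^ (2 * r + t)             ≡⟨ cong (Q *_) (trans (^-distribˡ-+-* S (2 * r) t)
                                          (cong (_* W) (trans (double-exponent S) (cong (_^ r) S²≡1+M)))) ⟩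
    Q * (suc M ^ r * W)             ≤⟨ *-monoʳ-≤ Q (*-monoˡ-≤ W ([1+M]^r≤2*M^r r M 2r≤M)) ⟩
    Q * (2 * M ^ r * W)             ≡⟨ cong (λ x → Q * (2 * x * W)) M^r≡ ⟩
    Q * (2 * (F * Q * P) * W)       ≡⟨ collect Q F P W ⟩
    2 * F * W * (P * Q * Q)         ∎)
  where
    open ≤-Reasoning
    X = volume (2 * r + t) r
    S = s + suc s
    M = 4 * suc s * s
    P = s ^ r
    Q = suc s ^ r
    T = suc s ^ t
    W = S ^ t
    F = 4 ^ r
    PQQ-pos : 1 ≤ P * Q * Q
    PQQ-pos = *-mono-≤ (*-mono-≤ (pow-pos s r 1≤s) (pow-pos (suc s) r (s≤s z≤n))) (pow-pos (suc s) r (s≤s z≤n))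
    double-exponent : ∀ x → x ^ (2 * r) ≡ (x * x) ^ r
    double-exponent x = trans (cong (x ^_) (cong (r +_) (+-identityʳ r)))
                              (trans (^-distribˡ-+-* x r r) (sym (^-distribʳ-* x x r)))
    S²≡1+M : S * S ≡ suc M
    S²≡1+M = square s
      where square : ∀ s → (s + suc s) * (s + suc s) ≡ suc (4 * suc s * s)
            square = solve-∀
    M^r≡ : M ^ r ≡ F * Q * P
    M^r≡ = trans (^-distribʳ-* (4 * suc s) s r) (cong (_* P) (^-distribʳ-* 4 (suc s) r))
    shuffle : ∀ X T P Q → X * T * (P * Q * Q) ≡ X * P * (Q * Q * T)
    shuffle = solve-∀
    collect : ∀ Q F P W → Q * (2 * (F * Q * P) * W) ≡ 2 * F * W * (P * Q * Q)
    collect = solve-∀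

-- If moreover t ≥ (2s+2) b, then ((2s+1)/(s+1))^t ≤ 2^t / 2^b, so
-- V(2r + t, r) 2^b ≤ 2 · 2^(2r+t).
volume-near-half : ∀ s r t b → 1 ≤ s → 2 * r ≤ 4 * suc s * s → suc (s + suc s) * b ≤ t →
                   volume (2 * r + t) r * 2 ^ b ≤ 2 * 2 ^ (2 * r + t)
volume-near-half s r t b 1≤s 2r≤M deficit = *-cancelʳ-≤′ _ _ W W-pos (begin
    X * 2 ^ b * W                   ≡⟨ shuffle X (2 ^ b) W ⟩
    X * (W * 2 ^ b)                 ≤⟨ *-monoʳ-≤ X (s^t*2^b≤[1+s]^t S b t deficit) ⟩
    X * suc S ^ t                   ≡⟨ cong (λ x → X * x ^ t) (twice s) ⟩
    X * (suc s * 2) ^ t             ≡⟨ cong (X *_) (^-distribʳ-* (suc s) 2 t) ⟩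
    X * (suc s ^ t * 2 ^ t)         ≡⟨ *-assoc X (suc s ^ t) (2 ^ t) ⟨
    X * suc s ^ t * 2 ^ t           ≤⟨ *-monoˡ-≤ (2 ^ t) (volume-near-half-factor s r t 1≤s 2r≤M) ⟩
    2 * 4 ^ r * W * 2 ^ t           ≡⟨ regroup (4 ^ r) W (2 ^ t) ⟩
    2 * (4 ^ r * 2 ^ t) * W         ≡⟨ cong (λ x → 2 * (x * 2 ^ t) * W) (^-*-assoc 2 2 r) ⟩
    2 * (2 ^ (2 * r) * 2 ^ t) * W   ≡⟨ cong (λ x → 2 * x * W) (^-distribˡ-+-* 2 (2 * r) t) ⟨
    2 * 2 ^ (2 * r + t) * W         ∎)
  where
    open ≤-Reasoning
    X = volume (2 * r + t) r
    S = s + suc s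
    W = S ^ t
    W-pos : 1 ≤ W
    W-pos = pow-pos S t (≤-trans 1≤s (m≤m+n s _))
    shuffle : ∀ X y W → X * y * W ≡ X * (W * y)
    shuffle = solve-∀
    twice : ∀ s → suc (s + suc s) ≡ suc s * 2
    twice = solve-∀
    regroup : ∀ F W x → 2 * F * W * x ≡ 2 * (F * x) * W
    regroup = solve-∀

-- Apply volume-near-half with s ≈ √n and
-- b = 4 ⌈log₂ n⌉, using (n - 2r)^2 ≥ 4 · 23^2 ⌈log₂ n⌉^2 n ≥ ((2s+2) b)^2.
mid-radius-volume : ∀ n r → 1 ≤ n → 2 * r ≤ n → 4 * (23 * 23) * (⌈log₂ n ⌉ ^ 2) * n ≤ (n ∸ 2 * r) ^ 2 →
                    volume n r * 2 ^ (4 * ⌈log₂ n ⌉) ≤ 2 * 2 ^ n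
mid-radius-volume n r 1≤n 2r≤n gap with square-between n 1≤n
... | s , 1≤s , n≤s² , s²≤8n =
  subst (λ x → volume x r * 2 ^ (4 * Λ) ≤ 2 * 2 ^ x) (m+[n∸m]≡n 2r≤n)
        (volume-near-half s r t (4 * Λ) 1≤s 2r≤M deficit)
  where
    open ≤-Reasoning
    Λ = ⌈log₂ n ⌉
    t = n ∸ 2 * r
    2r≤M : 2 * r ≤ 4 * suc s * s
    2r≤M = ≤-trans 2r≤n (≤-trans n≤s² (*-monoˡ-≤ s (≤-trans (n≤1+n s) (m≤n*m (suc s) 4))))
    deficit : suc (s + suc s) * (4 * Λ) ≤ t
    deficit = pow-cancel-≤ 1 _ _ (begin
      (suc (s + suc s) * (4 * Λ)) ^ 2     ≡⟨ expand s Λ ⟩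
      64 * (suc s * suc s) * (Λ * Λ)      ≤⟨ *-monoˡ-≤ (Λ * Λ) (*-monoʳ-≤ 64 (*-mono-≤ 1+s≤2s 1+s≤2s)) ⟩
      64 * ((s + s) * (s + s)) * (Λ * Λ)  ≡⟨ double s Λ ⟩
      256 * (s * s) * (Λ * Λ)             ≤⟨ *-monoˡ-≤ (Λ * Λ) (*-monoʳ-≤ 256 s²≤8n) ⟩
      256 * (8 * n) * (Λ * Λ)             ≡⟨ collect n Λ ⟩
      2048 * (Λ ^ 2 * n)                  ≤⟨ *-monoˡ-≤ (Λ ^ 2 * n) (≤ᵇ⇒≤ 2048 2116 _) ⟩
      2116 * (Λ ^ 2 * n)                  ≡⟨ *-assoc 2116 (Λ ^ 2) n ⟨
      4 * (23 * 23) * (Λ ^ 2) * n         ≤⟨ gap ⟩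
      t ^ 2                               ∎)
      where
        1+s≤2s : suc s ≤ s + s
        1+s≤2s = +-monoˡ-≤ s 1≤s
        expand : ∀ s L → (suc (s + suc s) * (4 * L)) * ((suc (s + suc s) * (4 * L)) * 1) ≡
                         64 * (suc s * suc s) * (L * L)
        expand = solve-∀
        double : ∀ s L → 64 * ((s + s) * (s + s)) * (L * L) ≡ 256 * (s * s) * (L * L)
        double = solve-∀
        collect : ∀ n L → 256 * (8 * n) * (L * L) ≡ 2048 * (L * (L * 1) * n)
        collect = solve-∀

-- n^2 ≤ 2^(4 ⌈log₂ n⌉), since n^4 ≤ (2^⌈log₂ n⌉)^4.
n²≤2^[4⌈log₂n⌉] : ∀ n → n * n ≤ 2 ^ (4 * ⌈log₂ n ⌉)
n²≤2^[4⌈log₂n⌉] zero          = z≤n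
n²≤2^[4⌈log₂n⌉] n@(suc _) = begin
    n * n                           ≤⟨ *-monoʳ-≤ n (m≤m*n n (n * (n * 1))) ⟩
    n * (n * (n * (n * 1)))         ≤⟨ ^-monoˡ-≤ 4 (≤2^⌈log₂⌉ n) ⟩
    (2 ^ ⌈log₂ n ⌉) ^ 4             ≡⟨ ^-*-assoc 2 ⌈log₂ n ⌉ 4 ⟩
    2 ^ (⌈log₂ n ⌉ * 4)             ≡⟨ cong (2 ^_) (*-comm ⌈log₂ n ⌉ 4) ⟩
    2 ^ (4 * ⌈log₂ n ⌉)             ∎
  where open ≤-Reasoning

-- (ii) asymptotics: under the hypothesis of mid-radius-volume, K(n, r) ≥ n^2/2,
-- which dominates the error term n - 1 + ⌈log₂ (r+1)⌉ ≤ 2 n once n ≥ 4 (m+2).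
A≤-asymptotic : ∀ m n r → 4 * suc (suc m) ≤ n → 2 * r ≤ n →
                4 * (23 * 23) * (⌈log₂ n ⌉ ^ 2) * n ≤ (n ∸ 2 * r) ^ 2 →
                ∀ k a → IsK n r k → IsA≤ n r a →
                suc m * a ≤ suc (suc m) * k × suc m * k ≤ suc (suc m) * a
A≤-asymptotic m n r large 2r≤n gap k a isK isA =
  ratio-bounds m k a (n + n) (proj₁ bounds) a≤k+2n mE≤k 2+m≤k
  where
    open ≤-Reasoning
    1≤n : 1 ≤ n
    1≤n = ≤-trans (s≤s z≤n) large
    bounds = A≤-bounds n r k a isK isA
    V = volume n r
    n²≤2k : n * n ≤ 2 * k
    n²≤2k = *-cancelʳ-≤′ _ _ V (volume-pos n r) (begin
      n * n * V                       ≤⟨ *-monoˡ-≤ V (n²≤2^[4⌈log₂n⌉] n) ⟩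
      2 ^ (4 * ⌈log₂ n ⌉) * V         ≡⟨ *-comm _ V ⟩
      V * 2 ^ (4 * ⌈log₂ n ⌉)         ≤⟨ mid-radius-volume n r 1≤n 2r≤n gap ⟩
      2 * 2 ^ n                       ≤⟨ *-monoʳ-≤ 2 (cover-volume (proj₁ isK)) ⟩
      2 * (k * V)                     ≡⟨ *-assoc 2 k V ⟨
      2 * k * V                       ∎)
    mE≤k : suc m * (n + n) ≤ k
    mE≤k = *-cancelˡ-≤′ _ _ 2 (s≤s z≤n) (begin
      2 * (suc m * (n + n))           ≡⟨ regroup (suc m) n ⟩
      4 * suc m * n                   ≤⟨ *-monoˡ-≤ n (*-monoʳ-≤ 4 (n≤1+n (suc m))) ⟩
      4 * suc (suc m) * n             ≤⟨ *-monoˡ-≤ n large ⟩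
      n * n                           ≤⟨ n²≤2k ⟩
      2 * k                           ∎)
      where regroup : ∀ x n → 2 * (x * (n + n)) ≡ 4 * x * n
            regroup = solve-∀
    2+m≤k : suc (suc m) ≤ k
    2+m≤k = ≤-trans (begin
      suc (suc m)                     ≤⟨ s≤s (m≤m+n (suc m) m) ⟩
      suc (suc m + m)                 ≡⟨ twice m ⟩
      suc m * (1 + 1)                 ≤⟨ *-monoʳ-≤ (suc m) (+-mono-≤ 1≤n 1≤n) ⟩
      suc m * (n + n)                 ∎) mE≤k
      where twice : ∀ m → suc (suc m + m) ≡ suc m * (1 + 1)
            twice = solve-∀
    log≤n : ⌈log₂ (suc r) ⌉ ≤ n
    log≤n = ⌈log₂⌉-least (suc r) n (≤-trans (s≤s (≤-trans (m≤m+n r (r + 0)) 2r≤n)) (1+n≤2^n n 1≤n))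
    a≤k+2n : a ≤ k + (n + n)
    a≤k+2n = begin
      a                                  ≤⟨ proj₂ bounds ⟩
      k + (n ∸ 1) + ⌈log₂ (suc r) ⌉      ≤⟨ +-mono-≤ (+-monoʳ-≤ k (m∸n≤m n 1)) log≤n ⟩
      k + n + n                          ≡⟨ +-assoc k n n ⟩
      k + (n + n)                        ∎

theorem1p1 :
    -- (i)
    (∀ (n : ℕ) → 1 ≤ n → ∀ (a : ℕ) → IsA n a →
       n ≤ a × a ≤ (n ∸ 1) + ⌈log₂ (suc n) ⌉)
  × -- (ii) bounds
    (∀ (n r : ℕ) → 1 ≤ n → ∀ (k a : ℕ) → IsK n r k → IsA≤ n r a →
       k ∸ 1 ≤ a × a ≤ k + (n ∸ 1) + ⌈log₂ (suc r) ⌉)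
  × -- (ii) asymptotics: r ≤ n/2 - C √n log n  ⇒  A(Q_n, ≤ r) = (1 + o(1)) K(n, r)
    (Σ ℕ λ C → ∀ (m : ℕ) → Σ ℕ λ N → ∀ (n r : ℕ) → N ≤ n →
       2 * r ≤ n → 4 * (C * C) * (⌈log₂ n ⌉ ^ 2) * n ≤ (n ∸ 2 * r) ^ 2 →
       ∀ (k a : ℕ) → IsK n r k → IsA≤ n r a →
       suc m * a ≤ suc (suc m) * k × suc m * k ≤ suc (suc m) * a)
  × -- (iii) bounds
    (∀ (n r : ℕ) → 1 ≤ n → r < n → ∀ (k a : ℕ) → IsK n r k → IsA= n r a →
       k ∸ 1 ≤ a × a ≤ k + binomSum n r)
  × -- (iii) asymptotics: r ≤ C' n (C' = p / (q + 1) > 0)  ⇒  A(Q_n, r) = (1 + o(1)) K(n, r)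
    (Σ ℕ λ p → Σ ℕ λ q → 1 ≤ p × (∀ (m : ℕ) → Σ ℕ λ N → ∀ (n r : ℕ) → N ≤ n →
       r < n → suc q * r ≤ p * n →
       ∀ (k a : ℕ) → IsK n r k → IsA= n r a →
       suc m * a ≤ suc (suc m) * k × suc m * k ≤ suc (suc m) * a))
theorem1p1 =
    (λ n _ → A-bounds n)
  , (λ n r _ → A≤-bounds n r)
  , (23 , λ m → 4 * suc (suc m) , A≤-asymptotic m)
  , (λ n r _ → A=-bounds n r)
  , (1 , 31 , ≤-refl , λ m → suc (suc m) ^ 4 * A₃ , λ n r large r<n 32r≤n →
       A=-asymptotic m n r large r<n (subst (32 * r ≤_) (*-identityˡ n) 32r≤n))
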